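{- For an integer $k\ge3$, $$\sum_{j=2}^{k-1}2^j\zeta(j,k-j)=(k+1)\zeta(k),$$ $$\sum_{j=2}^{k-1}2^j\zeta^{(2)}(j,\overline{k-j})+\sum_{j=2}^{k-1}2^j\zeta^{(2)}(\overline{j},\overline{k-j})=2\zeta(k)+2k\,\zeta^{(2)}(\overline{k}),$$ $$\sum_{j=2}^{k-1}2^j\zeta^{(2)}(\overline{j},k-j)=(k-1)\zeta(k)+2\zeta^{(2)}(\overline{k}).$$
   Context: $\zeta(k_1,\ldots,k_n)=\sum_{m_1>\cdots>m_n>0}1/(m_1^{k_1}\cdots m_n^{k_n})$. Alternating multiple zeta values: for positive integers $k_i$ and $a_i\in\{0,1\}$, $\zeta^{(2)}(\boxed{k_1},\ldots,\boxed{k_n})=\sum_{m_1>\cdots>m_n>0}(-1)^{a_1m_1+\cdots+a_nm_n}/(m_1^{k_1}\cdots m_n^{k_n})$, where $\boxed{k_i}$ is written $k_i$ if $a_i=0$ and $\overline{k_i}$ if $a_i=1$. -}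

module Defs where

open import Data.Nat as ℕ using (ℕ; zero; suc)
open import Data.Bool using (Bool; true; false; if_then_else_; _∧_; not)
open import Data.Product using (Σ)
import Data.Nat.Properties as ℕP
open import Data.Integer as ℤ using (ℤ)
open import Data.Rational as ℚ using (ℚ; _+_; _*_; _-_; -_; 0ℚ; 1ℚ)

sumTo : ℕ → (ℕ → ℚ) → ℚ
sumTo zero    f = 0ℚ
sumTo (suc n) f = sumTo n f + f (suc n)

odd : ℕ → Bool
odd zero = false
odd (suc n) = not (odd n)

sgn : Bool → ℕ → ℚ
sgn a m = if a ∧ odd m then - 1ℚ else 1ℚ

term : Bool → ℕ → ℕ → ℚ
term a k zero    = 0ℚ
term a k (suc i) = sgn a (suc i) * (ℤ.+ 1 ℚ./ (suc i ℕ.^ k))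
  where instance
          nz : ℕ.NonZero (suc i ℕ.^ k)
          nz = ℕP.m^n≢0 (suc i) k

-- N-th partial sum of the depth-1 alternating zeta value ζ^(2)(k) (bar iff a = true):
--   Σ_{N ≥ m > 0} (-1)^{a m} / m^k
zeta1 : ℕ → Bool → ℕ → ℚ
zeta1 N a k = sumTo N (term a k)

-- N-th partial sum of the depth-2 alternating MZV ζ^(2)(k₁, k₂) (bars given by a₁, a₂):
--   Σ_{N ≥ m₁ > m₂ > 0} (-1)^{a₁ m₁ + a₂ m₂} / (m₁^{k₁} m₂^{k₂})
zeta2 : ℕ → Bool → ℕ → Bool → ℕ → ℚ
zeta2 N a₁ k₁ a₂ k₂ = sumTo N (λ m₁ → term a₁ k₁ m₁ * sumTo (m₁ ℕ.∸ 1) (term a₂ k₂))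

sumJ : ℕ → (ℕ → ℚ) → ℚ
sumJ k f = sumTo (k ℕ.∸ 1) (λ j → if j ℕ.<ᵇ 2 then 0ℚ else ((ℤ.+ (2 ℕ.^ j)) ℚ./ 1) * f j)

nat : ℕ → ℚ
nat n = ℤ.+ n ℚ./ 1

TendsToZero : (ℕ → ℚ) → Set
TendsToZero s = ∀ (ε : ℚ) → 0ℚ ℚ.< ε → Σ ℕ λ N → ∀ n → N ℕ.≤ n → ℚ.∣ s n ∣ ℚ.< ε

module Submission where

-- Everything is proved for the truncated sums at level N, where each identity holds exactly
-- up to error terms that tend to zero. Let C_N(f, g) = Σ_{p+q ≤ N} f(p) g(q) be the truncated
-- Cauchy product. The partial fraction identity 1/(pq) = 1/(p+q) · (1/p + 1/q), applied to
-- each summand on the line m = p + q, gives with σ = s₁ xor s₂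
--   Σ_{j=1}^{k-1} 2^j (ζ_N(s₁ j, σ k−j) + ζ_N(s₂ j, σ k−j)) = 2 Σ_{a=1}^{k-1} C_N(s₁ a, s₂ k−a),
--   Σ_{j=1}^{k-1} ζ_N(s₁ j, σ k−j) = C_N(s₁ 1, s₂ k−1) − ζ_N(s₂ k−1, σ 1).
-- The stuffle product rewrites C_N(a, b) as ζ_N(a, b) + ζ_N(b, a) + ζ_N(a + b) up to the defect
-- ζ_N(a) ζ_N(b) − C_N(a, b), a sum over p, q ≤ N < p + q that is O(log N / N) when a + b ≥ 3.
-- Eliminating the depth-two sums leaves each identity with an error that is a fixed multiple
-- of this bound.

open import Algebra.Bundles using (CommutativeRing)
open import Data.Bool using (Bool; true; false; not; _∧_; _xor_; if_then_else_)
import Data.Bool.Properties as 𝔹P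
open import Data.Integer as ℤ using (ℤ)
import Data.Integer.Properties as ℤP
open import Data.Nat using (ℕ; zero; suc; _≤_; _<_; _∸_; z≤n; s≤s)
import Data.Nat as ℕ
import Data.Nat.Properties as ℕP
import Data.Nat.Tactic.RingSolver as ℕ-Ring
open import Data.List using ([]; _∷_)
open import Data.Product using (_×_; _,_; Σ)
open import Data.Sum using (inj₁; inj₂)
open import Data.Rational using (ℚ; mkℚ; _/_; _+_; _*_; _-_; -_; 0ℚ; 1ℚ; ∣_∣)
import Data.Rational as ℚ
import Data.Rational.Properties as ℚP
open import Data.Rational.Solver using (module +-*-Solver)
import Data.Rational.Unnormalised as ℚᵘ
import Data.Rational.Unnormalised.Properties as ℚᵘP
open import Relation.Binary.PropositionalEquality
open import Relation.Nullary using (¬_)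

open import Algebra.Properties.CommutativeSemigroup
  (CommutativeRing.*-commutativeSemigroup ℚP.+-*-commutativeRing) using (interchange)
open import Algebra.Properties.Semiring.Exp (CommutativeRing.semiring ℚP.+-*-commutativeRing)
  using (_^_; ^-homo-*)

open import Defs

open Data.Rational.Solver.+-*-Solver using (solve; _:=_; _:+_; _:*_; _:-_; :-_; con)

toℚᵘ-/ : ∀ (i : ℤ) n .{{_ : ℕ.NonZero n}} → ℚ.toℚᵘ (i / n) ℚᵘ.≃ (i ℚᵘ./ n)
toℚᵘ-/ i (suc d) = ℚP.toℚᵘ-fromℚᵘ (ℚᵘ.mkℚᵘ i d)

frac-cong : ∀ a b c d .{{_ : ℕ.NonZero b}} .{{_ : ℕ.NonZero d}} →
            a ℕ.* d ≡ c ℕ.* b → ℤ.+ a / b ≡ ℤ.+ c / d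
frac-cong a b@(suc _) c d@(suc _) eq = ℚP.toℚᵘ-injective
  (ℚᵘP.≃-trans (toℚᵘ-/ (ℤ.+ a) b)
  (ℚᵘP.≃-trans (ℚᵘ.*≡* (trans (sym (ℤP.pos-* a d)) (trans (cong ℤ.+_ eq) (ℤP.pos-* c b))))
               (ℚᵘP.≃-sym (toℚᵘ-/ (ℤ.+ c) d))))

frac-* : ∀ a b c d .{{_ : ℕ.NonZero b}} .{{_ : ℕ.NonZero d}} →
         (ℤ.+ a / b) * (ℤ.+ c / d) ≡ (ℤ.+ (a ℕ.* c) / (b ℕ.* d)) {{ℕP.m*n≢0 b d}}
frac-* a b@(suc _) c d@(suc _) = ℚP.toℚᵘ-injective
  (ℚᵘP.≃-trans (ℚP.toℚᵘ-homo-* (ℤ.+ a / b) (ℤ.+ c / d))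
  (ℚᵘP.≃-trans (ℚᵘP.*-cong (toℚᵘ-/ (ℤ.+ a) b) (toℚᵘ-/ (ℤ.+ c) d))
  (ℚᵘP.≃-trans (ℚᵘ.*≡* (cong (ℤ._* ℤ.+ (b ℕ.* d)) (sym (ℤP.pos-* a c))))
               (ℚᵘP.≃-sym (toℚᵘ-/ (ℤ.+ (a ℕ.* c)) (b ℕ.* d) {{ℕP.m*n≢0 b d}})))))

frac-+ : ∀ a b c d .{{_ : ℕ.NonZero b}} .{{_ : ℕ.NonZero d}} →
         (ℤ.+ a / b) + (ℤ.+ c / d) ≡ (ℤ.+ (a ℕ.* d ℕ.+ c ℕ.* b) / (b ℕ.* d)) {{ℕP.m*n≢0 b d}}
frac-+ a b@(suc _) c d@(suc _) = ℚP.toℚᵘ-injective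
  (ℚᵘP.≃-trans (ℚP.toℚᵘ-homo-+ (ℤ.+ a / b) (ℤ.+ c / d))
  (ℚᵘP.≃-trans (ℚᵘP.+-cong (toℚᵘ-/ (ℤ.+ a) b) (toℚᵘ-/ (ℤ.+ c) d))
  (ℚᵘP.≃-trans (ℚᵘ.*≡* (cong (ℤ._* ℤ.+ (b ℕ.* d)) numerator))
               (ℚᵘP.≃-sym (toℚᵘ-/ (ℤ.+ (a ℕ.* d ℕ.+ c ℕ.* b)) (b ℕ.* d) {{ℕP.m*n≢0 b d}})))))
  where
  numerator : ℤ.+ a ℤ.* ℤ.+ d ℤ.+ ℤ.+ c ℤ.* ℤ.+ b ≡ ℤ.+ (a ℕ.* d ℕ.+ c ℕ.* b)
  numerator = trans (cong₂ ℤ._+_ (sym (ℤP.pos-* a d)) (sym (ℤP.pos-* c b)))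
                    (sym (ℤP.pos-+ (a ℕ.* d) (c ℕ.* b)))

frac-≤ : ∀ a b c d .{{_ : ℕ.NonZero b}} .{{_ : ℕ.NonZero d}} →
              a ℕ.* d ≤ c ℕ.* b → ℤ.+ a / b ℚ.≤ ℤ.+ c / d
frac-≤ a b@(suc _) c d@(suc _) le = ℚP.toℚᵘ-cancel-≤
  (ℚᵘP.≤-respʳ-≃ (ℚᵘP.≃-sym (toℚᵘ-/ (ℤ.+ c) d)) (ℚᵘP.≤-respˡ-≃ (ℚᵘP.≃-sym (toℚᵘ-/ (ℤ.+ a) b))
     (ℚᵘ.*≤* (subst₂ ℤ._≤_ (ℤP.pos-* a d) (ℤP.pos-* c b) (ℤ.+≤+ le)))))

frac-< : ∀ a b c d .{{_ : ℕ.NonZero b}} .{{_ : ℕ.NonZero d}} →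
              a ℕ.* d < c ℕ.* b → ℤ.+ a / b ℚ.< ℤ.+ c / d
frac-< a b@(suc _) c d@(suc _) lt = ℚP.toℚᵘ-cancel-<
  (ℚᵘP.<-respʳ-≃ (ℚᵘP.≃-sym (toℚᵘ-/ (ℤ.+ c) d)) (ℚᵘP.<-respˡ-≃ (ℚᵘP.≃-sym (toℚᵘ-/ (ℤ.+ a) b))
     (ℚᵘ.*<* (subst₂ ℤ._<_ (ℤP.pos-* a d) (ℤP.pos-* c b) (ℤ.+<+ lt)))))

nat-suc : ∀ n → nat (suc n) ≡ nat n + 1ℚ
nat-suc n = sym (trans (frac-+ n 1 1 1) (frac-cong (n ℕ.* 1 ℕ.+ 1 ℕ.* 1) 1 (suc n) 1 (ℕ-Ring.solve (n ∷ []))))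

nat-* : ∀ m n → nat (m ℕ.* n) ≡ nat m * nat n
nat-* m n = sym (frac-* m 1 n 1)

nat-suc-* : ∀ n x → nat (suc n) * x ≡ nat n * x + x
nat-suc-* n x = trans (cong (_* x) (nat-suc n))
  (solve 2 (λ n x → (n :+ con 1ℚ) :* x := n :* x :+ x) refl (nat n) x)

nat-nonNeg : ∀ n → 0ℚ ℚ.≤ nat n
nat-nonNeg n = frac-≤ 0 1 n 1 z≤n

sumTo-cong : ∀ n {f g : ℕ → ℚ} → (∀ i → i < n → f (suc i) ≡ g (suc i)) → sumTo n f ≡ sumTo n g
sumTo-cong zero    eq = refl
sumTo-cong (suc n) eq = cong₂ _+_ (sumTo-cong n (λ i i<n → eq i (ℕP.m<n⇒m<1+n i<n))) (eq n ℕP.≤-refl)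

sumTo-+ : ∀ n (f g : ℕ → ℚ) → sumTo n (λ i → f i + g i) ≡ sumTo n f + sumTo n g
sumTo-+ zero    f g = refl
sumTo-+ (suc n) f g = trans (cong (_+ (f (suc n) + g (suc n))) (sumTo-+ n f g))
  (solve 4 (λ a b c d → (a :+ b) :+ (c :+ d) := (a :+ c) :+ (b :+ d)) refl
     (sumTo n f) (sumTo n g) (f (suc n)) (g (suc n)))

sumTo-*ˡ : ∀ n c (f : ℕ → ℚ) → sumTo n (λ i → c * f i) ≡ c * sumTo n f
sumTo-*ˡ zero    c f = sym (ℚP.*-zeroʳ c)
sumTo-*ˡ (suc n) c f = trans (cong (_+ (c * f (suc n))) (sumTo-*ˡ n c f))
  (sym (ℚP.*-distribˡ-+ c (sumTo n f) (f (suc n))))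

sumTo-*ʳ : ∀ n (f : ℕ → ℚ) c → sumTo n (λ i → f i * c) ≡ sumTo n f * c
sumTo-*ʳ n f c = trans (sumTo-cong n (λ i _ → ℚP.*-comm (f (suc i)) c))
  (trans (sumTo-*ˡ n c f) (ℚP.*-comm c (sumTo n f)))

sumTo-neg : ∀ n (f : ℕ → ℚ) → sumTo n (λ i → - f i) ≡ - sumTo n f
sumTo-neg zero    f = refl
sumTo-neg (suc n) f = trans (cong (_+ (- f (suc n))) (sumTo-neg n f))
  (sym (ℚP.neg-distrib-+ (sumTo n f) (f (suc n))))

sumTo-- : ∀ n (f g : ℕ → ℚ) → sumTo n (λ i → f i - g i) ≡ sumTo n f - sumTo n g
sumTo-- n f g = trans (sumTo-+ n f (λ i → - g i)) (cong (sumTo n f +_) (sumTo-neg n g))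

sumTo-0 : ∀ n → sumTo n (λ _ → 0ℚ) ≡ 0ℚ
sumTo-0 zero    = refl
sumTo-0 (suc n) = trans (ℚP.+-identityʳ _) (sumTo-0 n)

sumTo-const : ∀ n c → sumTo n (λ _ → c) ≡ nat n * c
sumTo-const zero    c = sym (ℚP.*-zeroˡ c)
sumTo-const (suc n) c = trans (cong (_+ c) (sumTo-const n c)) (sym (nat-suc-* n c))

sumTo-comm : ∀ n m (F : ℕ → ℕ → ℚ) →
             sumTo n (λ i → sumTo m (F i)) ≡ sumTo m (λ j → sumTo n (λ i → F i j))
sumTo-comm zero    m F = sym (sumTo-0 m)
sumTo-comm (suc n) m F = trans (cong (_+ sumTo m (F (suc n))) (sumTo-comm n m F))
  (sym (sumTo-+ m (λ j → sumTo n (λ i → F i j)) (F (suc n))))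

sumTo-unfoldˡ : ∀ n (f : ℕ → ℚ) → sumTo (suc n) f ≡ f 1 + sumTo n (λ i → f (suc i))
sumTo-unfoldˡ zero    f = trans (ℚP.+-identityˡ (f 1)) (sym (ℚP.+-identityʳ (f 1)))
sumTo-unfoldˡ (suc n) f = trans (cong (_+ f (suc (suc n))) (sumTo-unfoldˡ n f))
  (ℚP.+-assoc (f 1) (sumTo n (λ i → f (suc i))) (f (suc (suc n))))

sumTo-reverse : ∀ n (f : ℕ → ℚ) → sumTo n f ≡ sumTo n (λ i → f (suc n ∸ i))
sumTo-reverse zero    f = refl
sumTo-reverse (suc n) f = trans (ℚP.+-comm (sumTo n f) (f (suc n)))
  (trans (cong (f (suc n) +_) (sumTo-reverse n f))
         (sym (sumTo-unfoldˡ n (λ i → f (suc (suc n) ∸ i)))))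

sumTo-split : ∀ a b (f : ℕ → ℚ) → sumTo (a ℕ.+ b) f ≡ sumTo a f + sumTo b (λ i → f (a ℕ.+ i))
sumTo-split a zero    f = trans (cong (λ n → sumTo n f) (ℕP.+-identityʳ a))
  (sym (ℚP.+-identityʳ (sumTo a f)))
sumTo-split a (suc b) f = begin
    sumTo (a ℕ.+ suc b) f
  ≡⟨ cong (λ n → sumTo n f) (ℕP.+-suc a b) ⟩
    sumTo (a ℕ.+ b) f + f (suc (a ℕ.+ b))
  ≡⟨ cong₂ _+_ (sumTo-split a b f) (cong f (sym (ℕP.+-suc a b))) ⟩
    sumTo a f + sumTo b (λ i → f (a ℕ.+ i)) + f (a ℕ.+ suc b)
  ≡⟨ ℚP.+-assoc (sumTo a f) _ _ ⟩
    sumTo a f + sumTo (suc b) (λ i → f (a ℕ.+ i))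
  ∎
  where open ≡-Reasoning

∣sumTo∣≤sumTo∣∣ : ∀ n (f : ℕ → ℚ) → ∣ sumTo n f ∣ ℚ.≤ sumTo n (λ i → ∣ f i ∣)
∣sumTo∣≤sumTo∣∣ zero    f = ℚP.≤-refl
∣sumTo∣≤sumTo∣∣ (suc n) f = ℚP.≤-trans (ℚP.∣p+q∣≤∣p∣+∣q∣ (sumTo n f) (f (suc n)))
  (ℚP.+-monoˡ-≤ ∣ f (suc n) ∣ (∣sumTo∣≤sumTo∣∣ n f))

sumTo-mono-≤ : ∀ n {f g : ℕ → ℚ} → (∀ i → i < n → f (suc i) ℚ.≤ g (suc i)) →
               sumTo n f ℚ.≤ sumTo n g
sumTo-mono-≤ zero    le = ℚP.≤-refl
sumTo-mono-≤ (suc n) le = ℚP.+-mono-≤ (sumTo-mono-≤ n (λ i i<n → le i (ℕP.m<n⇒m<1+n i<n)))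
                                      (le n ℕP.≤-refl)

-- Triangle sums, the stuffle product and the Cauchy product

triSum : ℕ → (ℕ → ℕ → ℚ) → ℚ
triSum N F = sumTo N (λ m → sumTo (m ∸ 1) (F m))

triSum-cong : ∀ N {F G : ℕ → ℕ → ℚ} →
              (∀ m n → 1 ≤ n → n < m → m ≤ N → F m n ≡ G m n) → triSum N F ≡ triSum N G
triSum-cong N eq = sumTo-cong N (λ i i<N → sumTo-cong i (λ j j<i →
  eq (suc i) (suc j) (s≤s z≤n) (s≤s j<i) i<N))

triSum-+ : ∀ N (F G : ℕ → ℕ → ℚ) → triSum N (λ m n → F m n + G m n) ≡ triSum N F + triSum N G
triSum-+ N F G = trans (sumTo-cong N (λ i _ → sumTo-+ i (F (suc i)) (G (suc i)))) (sumTo-+ N _ _)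

triSum-- : ∀ N (F G : ℕ → ℕ → ℚ) → triSum N (λ m n → F m n - G m n) ≡ triSum N F - triSum N G
triSum-- N F G = trans (sumTo-cong N (λ i _ → sumTo-- i (F (suc i)) (G (suc i)))) (sumTo-- N _ _)

triSum-*ˡ : ∀ N c (F : ℕ → ℕ → ℚ) → triSum N (λ m n → c * F m n) ≡ c * triSum N F
triSum-*ˡ N c F = trans (sumTo-cong N (λ i _ → sumTo-*ˡ i c (F (suc i)))) (sumTo-*ˡ N c _)

sumTo-triSum-comm : ∀ K N (F : ℕ → ℕ → ℕ → ℚ) →
                    sumTo K (λ j → triSum N (F j)) ≡ triSum N (λ m n → sumTo K (λ j → F j m n))
sumTo-triSum-comm K N F = trans (sumTo-comm K N (λ j m → sumTo (m ∸ 1) (F j m)))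
  (sumTo-cong N (λ i _ → sumTo-comm K i (λ j n → F j (suc i) n)))

triSum-reflect : ∀ N (F : ℕ → ℕ → ℚ) → triSum N (λ m n → F m (m ∸ n)) ≡ triSum N F
triSum-reflect N F = sumTo-cong N (λ i _ → sym (sumTo-reverse i (F (suc i))))

triSum-shear : ∀ N (h : ℕ → ℕ → ℚ) →
               triSum N (λ m n → h (m ∸ n) n) ≡ sumTo N (λ p → sumTo (N ∸ p) (h p))
triSum-shear zero    h = refl
triSum-shear (suc N) h = begin
    triSum N (λ m n → h (m ∸ n) n) + sumTo N (λ n → h (suc N ∸ n) n)
  ≡⟨ cong₂ _+_ (triSum-shear N h) (trans (sumTo-reverse N (λ n → h (suc N ∸ n) n))
       (sumTo-cong N (λ i i<N → cong (λ p → h p (N ∸ i))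
          (ℕP.m∸[m∸n]≡n {suc N} {suc i} (ℕP.m≤n⇒m≤1+n i<N))))) ⟩
    sumTo N (λ p → sumTo (N ∸ p) (h p)) + sumTo N (λ p → h p (suc N ∸ p))
  ≡⟨ sumTo-+ N _ _ ⟨
    sumTo N (λ p → sumTo (N ∸ p) (h p) + h p (suc N ∸ p))
  ≡⟨ sumTo-cong N (λ i i<N → trans
       (cong (λ q → sumTo (N ∸ suc i) (h (suc i)) + h (suc i) q) (ℕP.+-∸-assoc 1 i<N))
       (cong (λ n → sumTo n (h (suc i))) (sym (ℕP.+-∸-assoc 1 i<N)))) ⟩
    sumTo N (λ p → sumTo (suc N ∸ p) (h p))
  ≡⟨ ℚP.+-identityʳ _ ⟨
    sumTo N (λ p → sumTo (suc N ∸ p) (h p)) + 0ℚ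
  ≡⟨ cong (λ n → sumTo N (λ p → sumTo (suc N ∸ p) (h p)) + sumTo n (h (suc N))) (ℕP.n∸n≡0 N) ⟨
    sumTo N (λ p → sumTo (suc N ∸ p) (h p)) + sumTo (suc N ∸ suc N) (h (suc N))
  ∎
  where open ≡-Reasoning

stuffle : ∀ N (f g : ℕ → ℚ) → sumTo N f * sumTo N g ≡
  triSum N (λ m n → f m * g n) + triSum N (λ m n → g m * f n) + sumTo N (λ m → f m * g m)
stuffle zero    f g = refl
stuffle (suc N) f g = begin
    (F + f′) * (G + g′)
  ≡⟨ solve 4 (λ F f′ G g′ → (F :+ f′) :* (G :+ g′) := F :* G :+ f′ :* G :+ g′ :* F :+ f′ :* g′)
       refl F f′ G g′ ⟩
    F * G + f′ * G + g′ * F + f′ * g′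
  ≡⟨ cong (λ x → x + f′ * G + g′ * F + f′ * g′) (stuffle N f g) ⟩
    D₁ + D₂ + S + f′ * G + g′ * F + f′ * g′
  ≡⟨ cong₂ (λ x y → D₁ + D₂ + S + x + y + f′ * g′) (sym (sumTo-*ˡ N f′ g)) (sym (sumTo-*ˡ N g′ f)) ⟩
    D₁ + D₂ + S + f′G + g′F + f′ * g′
  ≡⟨ solve 6 (λ D₁ D₂ S a b c → D₁ :+ D₂ :+ S :+ a :+ b :+ c := (D₁ :+ a) :+ (D₂ :+ b) :+ (S :+ c))
       refl D₁ D₂ S f′G g′F (f′ * g′) ⟩
    (D₁ + f′G) + (D₂ + g′F) + (S + f′ * g′)
  ∎
  where
  open ≡-Reasoning
  F = sumTo N f
  G = sumTo N g
  f′ = f (suc N)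
  g′ = g (suc N)
  f′G = sumTo N (λ n → f′ * g n)
  g′F = sumTo N (λ n → g′ * f n)
  D₁ = triSum N (λ m n → f m * g n)
  D₂ = triSum N (λ m n → g m * f n)
  S = sumTo N (λ m → f m * g m)

cauchy : ℕ → (ℕ → ℚ) → (ℕ → ℚ) → ℚ
cauchy N f g = triSum N (λ m n → f (m ∸ n) * g n)

sumTo-*-sumTo-∸-cauchy : ∀ N (f g : ℕ → ℚ) →
  sumTo N f * sumTo N g - cauchy N f g ≡ sumTo N (λ p → f p * sumTo p (λ i → g (N ∸ p ℕ.+ i)))
sumTo-*-sumTo-∸-cauchy N f g = begin
    sumTo N f * sumTo N g - cauchy N f g
  ≡⟨ cong₂ _-_ (sym (sumTo-*ʳ N f (sumTo N g))) (triSum-shear N (λ p q → f p * g q)) ⟩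
    sumTo N (λ p → f p * sumTo N g) - sumTo N (λ p → sumTo (N ∸ p) (λ q → f p * g q))
  ≡⟨ sumTo-- N _ _ ⟨
    sumTo N (λ p → f p * sumTo N g - sumTo (N ∸ p) (λ q → f p * g q))
  ≡⟨ sumTo-cong N (λ i i<N → tail (suc i) i<N) ⟩
    sumTo N (λ p → f p * sumTo p (λ i → g (N ∸ p ℕ.+ i)))
  ∎
  where
  open ≡-Reasoning
  tail : ∀ p → p ≤ N → f p * sumTo N g - sumTo (N ∸ p) (λ q → f p * g q)
                       ≡ f p * sumTo p (λ i → g (N ∸ p ℕ.+ i))
  tail p p≤N = begin
      f p * sumTo N g - sumTo (N ∸ p) (λ q → f p * g q)
    ≡⟨ cong₂ (λ x y → f p * x - y)
         (trans (cong (λ n → sumTo n g) (sym (ℕP.m∸n+n≡m p≤N))) (sumTo-split (N ∸ p) p g))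
         (sumTo-*ˡ (N ∸ p) (f p) g) ⟩
      f p * (sumTo (N ∸ p) g + sumTo p (λ i → g (N ∸ p ℕ.+ i))) - f p * sumTo (N ∸ p) g
    ≡⟨ solve 3 (λ a x y → a :* (x :+ y) :- a :* x := a :* y) refl
         (f p) (sumTo (N ∸ p) g) (sumTo p (λ i → g (N ∸ p ℕ.+ i))) ⟩
      f p * sumTo p (λ i → g (N ∸ p ℕ.+ i))
    ∎

-- A partial fraction identity

*-cancelˡ-≡ : ∀ w {p q} → ¬ (w ≡ 0ℚ) → w * p ≡ w * q → p ≡ q
*-cancelˡ-≡ w {p} {q} w≢0 eq = begin
  p                 ≡⟨ ℚP.*-identityˡ p ⟨
  1ℚ * p            ≡⟨ cong (_* p) (ℚP.*-inverseˡ w) ⟨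
  (w⁻¹ * w) * p     ≡⟨ ℚP.*-assoc w⁻¹ w p ⟩
  w⁻¹ * (w * p)     ≡⟨ cong (w⁻¹ *_) eq ⟩
  w⁻¹ * (w * q)     ≡⟨ ℚP.*-assoc w⁻¹ w q ⟨
  (w⁻¹ * w) * q     ≡⟨ cong (_* q) (ℚP.*-inverseˡ w) ⟩
  1ℚ * q            ≡⟨ ℚP.*-identityˡ q ⟩
  q                 ∎
  where
  open ≡-Reasoning
  instance _ = ℚ.≢-nonZero w≢0
  w⁻¹ = ℚ.1/ w

mixedSum : ℚ → ℚ → ℕ → ℚ
mixedSum x y k = sumTo (k ∸ 1) (λ a → x ^ a * y ^ (k ∸ a))

weightedSum : ℚ → ℚ → ℚ → ℕ → ℚ
weightedSum x y z k = sumTo (k ∸ 1) (λ j → nat (2 ℕ.^ j) * (z ^ j * (y ^ (k ∸ j) + x ^ (k ∸ j))))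

zySum : ℚ → ℚ → ℕ → ℚ
zySum y z k = sumTo (k ∸ 1) (λ j → z ^ j * y ^ (k ∸ j))

-- For x = 1/p, y = 1/q and z = 1/(p+q) the relation below is the partial fraction
-- identity 1/(pq) = 1/(p+q) · (1/p + 1/q).
module PartialFractions (x y z : ℚ) (xy≡z[x+y] : x * y ≡ z * (x + y)) where

  private
    L = mixedSum x y
    R = weightedSum x y z
    M = zySum y z

    y^[1+n∸i] : ∀ {n i} → i ≤ n → y ^ (suc n ∸ i) ≡ y * y ^ (n ∸ i)
    y^[1+n∸i] i≤n = cong (y ^_) (ℕP.+-∸-assoc 1 i≤n)

    y^[2+n∸[1+n]] : ∀ n → y ^ (suc (suc n) ∸ suc n) ≡ y
    y^[2+n∸[1+n]] n = trans (cong (y ^_) (ℕP.m+n∸n≡m 1 n)) (ℚP.*-identityʳ y)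

  mixedSum-sucʳ : ∀ n → L (suc (suc n)) ≡ x ^ suc n * y + y * L (suc n)
  mixedSum-sucʳ n = begin
      sumTo n (λ a → x ^ a * y ^ (suc (suc n) ∸ a)) + x ^ suc n * y ^ (suc (suc n) ∸ suc n)
    ≡⟨ cong₂ _+_ (sumTo-cong n (λ i i<n → cong (x ^ suc i *_) (y^[1+n∸i] (ℕP.<⇒≤ i<n))))
                 (cong (x ^ suc n *_) (y^[2+n∸[1+n]] n)) ⟩
      sumTo n (λ a → x ^ a * (y * y ^ (suc n ∸ a))) + x ^ suc n * y
    ≡⟨ cong (_+ x ^ suc n * y) (trans
         (sumTo-cong n (λ i _ → solve 3 (λ a b y → a :* (y :* b) := y :* (a :* b)) refl
            (x ^ suc i) (y ^ (suc n ∸ suc i)) y))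
         (sumTo-*ˡ n y (λ a → x ^ a * y ^ (suc n ∸ a)))) ⟩
      y * L (suc n) + x ^ suc n * y
    ≡⟨ ℚP.+-comm (y * L (suc n)) (x ^ suc n * y) ⟩
      x ^ suc n * y + y * L (suc n)
    ∎
    where open ≡-Reasoning

  mixedSum-sucˡ : ∀ n → L (suc (suc n)) ≡ x * y ^ suc n + x * L (suc n)
  mixedSum-sucˡ n = begin
      sumTo (suc n) (λ a → x ^ a * y ^ (suc (suc n) ∸ a))
    ≡⟨ sumTo-unfoldˡ n _ ⟩
      x ^ 1 * y ^ suc n + sumTo n (λ a → x ^ suc a * y ^ (suc n ∸ a))
    ≡⟨ cong₂ _+_ (cong (_* y ^ suc n) (ℚP.*-identityʳ x))
         (trans (sumTo-cong n (λ i _ → ℚP.*-assoc x (x ^ suc i) (y ^ (suc n ∸ suc i))))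
                (sumTo-*ˡ n x (λ a → x ^ a * y ^ (suc n ∸ a)))) ⟩
      x * y ^ suc n + x * L (suc n)
    ∎
    where open ≡-Reasoning

  mixedSum-rec : ¬ (x + y ≡ 0ℚ) → ∀ n →
                 L (suc (suc n)) ≡ z * (nat 2 * L (suc n) + x ^ suc n + y ^ suc n)
  mixedSum-rec x+y≢0 n = *-cancelˡ-≡ (x + y) x+y≢0 (begin
      (x + y) * L₂
    ≡⟨ ℚP.*-distribʳ-+ L₂ x y ⟩
      x * L₂ + y * L₂
    ≡⟨ cong₂ (λ a b → x * a + y * b) (mixedSum-sucʳ n) (mixedSum-sucˡ n) ⟩
      x * (X * y + y * L₁) + y * (x * Y + x * L₁)
    ≡⟨ solve 5 (λ x y l X Y → x :* (X :* y :+ y :* l) :+ y :* (x :* Y :+ x :* l)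
                              := (x :* y) :* (con (nat 2) :* l :+ X :+ Y)) refl x y L₁ X Y ⟩
      (x * y) * W
    ≡⟨ cong (_* W) xy≡z[x+y] ⟩
      (z * (x + y)) * W
    ≡⟨ solve 3 (λ z s w → (z :* s) :* w := s :* (z :* w)) refl z (x + y) W ⟩
      (x + y) * (z * W)
    ∎)
    where
    open ≡-Reasoning
    L₁ = L (suc n)
    L₂ = L (suc (suc n))
    X = x ^ suc n
    Y = y ^ suc n
    W = nat 2 * L₁ + X + Y

  weightedSum-rec : ∀ n → R (suc (suc n)) ≡
    nat 2 * z * (y ^ suc n + x ^ suc n) + nat 2 * z * R (suc n)
  weightedSum-rec n = begin
      R (suc (suc n))
    ≡⟨ sumTo-unfoldˡ n _ ⟩
      nat 2 * (z ^ 1 * S (suc n)) + sumTo n (λ j → nat (2 ℕ.^ suc j) * (z ^ suc j * S (suc n ∸ j)))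
    ≡⟨ cong₂ _+_ (solve 3 (λ t z w → t :* (z :* con 1ℚ :* w) := t :* z :* w) refl (nat 2) z (S (suc n)))
         (trans (sumTo-cong n (λ i _ → trans
                   (cong (_* (z ^ suc (suc i) * S (suc n ∸ suc i))) (nat-* 2 (2 ℕ.^ suc i)))
                   (solve 5 (λ t c zⱼ z w → (t :* c) :* ((z :* zⱼ) :* w) := (t :* z) :* (c :* (zⱼ :* w)))
                      refl (nat 2) (nat (2 ℕ.^ suc i)) (z ^ suc i) z (S (suc n ∸ suc i)))))
                (sumTo-*ˡ n (nat 2 * z) _)) ⟩
      nat 2 * z * S (suc n) + nat 2 * z * R (suc n)
    ∎
    where
    open ≡-Reasoning
    S : ℕ → ℚ
    S e = y ^ e + x ^ e

  weightedSum≡2*mixedSum : ¬ (x + y ≡ 0ℚ) → ∀ k → R k ≡ nat 2 * L k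
  weightedSum≡2*mixedSum x+y≢0 zero          = sym (ℚP.*-zeroʳ (nat 2))
  weightedSum≡2*mixedSum x+y≢0 (suc zero)    = sym (ℚP.*-zeroʳ (nat 2))
  weightedSum≡2*mixedSum x+y≢0 (suc (suc n)) = begin
      R (suc (suc n))
    ≡⟨ weightedSum-rec n ⟩
      nat 2 * z * (Y + X) + nat 2 * z * R (suc n)
    ≡⟨ cong (λ w → nat 2 * z * (Y + X) + nat 2 * z * w) (weightedSum≡2*mixedSum x+y≢0 (suc n)) ⟩
      nat 2 * z * (Y + X) + nat 2 * z * (nat 2 * L₁)
    ≡⟨ solve 5 (λ t z Y X l → t :* z :* (Y :+ X) :+ t :* z :* (t :* l) := t :* (z :* (t :* l :+ X :+ Y)))
         refl (nat 2) z Y X L₁ ⟩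
      nat 2 * (z * (nat 2 * L₁ + X + Y))
    ≡⟨ cong (nat 2 *_) (mixedSum-rec x+y≢0 n) ⟨
      nat 2 * L (suc (suc n))
    ∎
    where
    open ≡-Reasoning
    L₁ = L (suc n)
    X = x ^ suc n
    Y = y ^ suc n

  zySum-closed : ∀ n → M (suc n) ≡ x * (y ^ n - z ^ n)
  zySum-closed zero    = solve 1 (λ x → con 0ℚ := x :* (con 1ℚ :- con 1ℚ)) refl x
  zySum-closed (suc n) = begin
      sumTo n (λ j → z ^ j * y ^ (suc (suc n) ∸ j)) + z ^ suc n * y ^ (suc (suc n) ∸ suc n)
    ≡⟨ cong₂ _+_ (sumTo-cong n (λ i i<n → cong (z ^ suc i *_) (y^[1+n∸i] (ℕP.<⇒≤ i<n))))
                 (cong (z ^ suc n *_) (y^[2+n∸[1+n]] n)) ⟩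
      sumTo n (λ j → z ^ j * (y * y ^ (suc n ∸ j))) + z ^ suc n * y
    ≡⟨ cong (_+ z ^ suc n * y) (trans
         (sumTo-cong n (λ i _ → solve 3 (λ a b y → a :* (y :* b) := y :* (a :* b)) refl
            (z ^ suc i) (y ^ (suc n ∸ suc i)) y))
         (sumTo-*ˡ n y (λ j → z ^ j * y ^ (suc n ∸ j)))) ⟩
      y * M (suc n) + z * Z * y
    ≡⟨ cong (λ w → y * w + z * Z * y) (zySum-closed n) ⟩
      y * (x * (Y - Z)) + z * Z * y
    ≡⟨ solve 5 (λ x y z Y Z → y :* (x :* (Y :- Z)) :+ z :* Z :* y
                              := x :* (y :* Y) :- (x :* y) :* Z :+ Z :* (z :* y)) refl x y z Y Z ⟩
      x * (y * Y) - (x * y) * Z + Z * (z * y)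
    ≡⟨ cong (λ w → x * (y * Y) - w * Z + Z * (z * y)) xy≡z[x+y] ⟩
      x * (y * Y) - (z * (x + y)) * Z + Z * (z * y)
    ≡⟨ solve 5 (λ x y z Y Z → x :* (y :* Y) :- (z :* (x :+ y)) :* Z :+ Z :* (z :* y) := x :* (y :* Y :- z :* Z))
         refl x y z Y Z ⟩
      x * (y * Y - z * Z)
    ∎
    where
    open ≡-Reasoning
    Y = y ^ n
    Z = z ^ n

*-nonNeg : ∀ {p q} → 0ℚ ℚ.≤ p → 0ℚ ℚ.≤ q → 0ℚ ℚ.≤ p * q
*-nonNeg {p} {q} 0≤p 0≤q = ℚP.nonNegative⁻¹ (p * q)
  {{ℚP.nonNeg*nonNeg⇒nonNeg p {{ℚ.nonNegative 0≤p}} q {{ℚ.nonNegative 0≤q}}}}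

^-nonNeg : ∀ {x} n → 0ℚ ℚ.≤ x → 0ℚ ℚ.≤ x ^ n
^-nonNeg zero    _   = nat-nonNeg 1
^-nonNeg (suc n) 0≤x = *-nonNeg 0≤x (^-nonNeg n 0≤x)

recip : ℕ → ℚ
recip zero    = 0ℚ
recip (suc i) = ℤ.+ 1 / suc i

recip-nonNeg : ∀ p → 0ℚ ℚ.≤ recip p
recip-nonNeg zero    = ℚP.≤-refl
recip-nonNeg (suc p) = frac-≤ 0 1 1 (suc p) z≤n

recip-pos : ∀ {p} → 1 ≤ p → 0ℚ ℚ.< recip p
recip-pos {suc p} _ = frac-< 0 1 1 (suc p) (s≤s z≤n)

recip-+ : ∀ {p q} → 1 ≤ p → 1 ≤ q → recip p * recip q ≡ recip (p ℕ.+ q) * (recip p + recip q)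
recip-+ {suc p} {suc q} _ _ = begin
    recip (suc p) * recip (suc q)
  ≡⟨ frac-* 1 (suc p) 1 (suc q) ⟩
    ℤ.+ 1 / (suc p ℕ.* suc q)
  ≡⟨ frac-cong 1 (suc p ℕ.* suc q) (1 ℕ.* (1 ℕ.* suc q ℕ.+ 1 ℕ.* suc p))
       (suc (p ℕ.+ suc q) ℕ.* (suc p ℕ.* suc q)) (ℕ-Ring.solve (p ∷ q ∷ [])) ⟩
    ℤ.+ (1 ℕ.* (1 ℕ.* suc q ℕ.+ 1 ℕ.* suc p)) / (suc (p ℕ.+ suc q) ℕ.* (suc p ℕ.* suc q))
  ≡⟨ frac-* 1 (suc (p ℕ.+ suc q)) (1 ℕ.* suc q ℕ.+ 1 ℕ.* suc p) (suc p ℕ.* suc q) ⟨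
    recip (suc (p ℕ.+ suc q)) * (ℤ.+ (1 ℕ.* suc q ℕ.+ 1 ℕ.* suc p) / (suc p ℕ.* suc q))
  ≡⟨ cong (recip (suc (p ℕ.+ suc q)) *_) (frac-+ 1 (suc p) 1 (suc q)) ⟨
    recip (suc (p ℕ.+ suc q)) * (recip (suc p) + recip (suc q))
  ∎
  where open ≡-Reasoning

1/[1+i]^k≡recip^k : ∀ i k → (ℤ.+ 1 / (suc i ℕ.^ k)) {{ℕP.m^n≢0 (suc i) k}} ≡ recip (suc i) ^ k
1/[1+i]^k≡recip^k i zero    = refl
1/[1+i]^k≡recip^k i (suc k) = begin
    (ℤ.+ 1 / (suc i ℕ.* suc i ℕ.^ k)) {{ℕP.m^n≢0 (suc i) (suc k)}}
  ≡⟨ frac-* 1 (suc i) 1 (suc i ℕ.^ k) {{_}} {{ℕP.m^n≢0 (suc i) k}} ⟨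
    recip (suc i) * (ℤ.+ 1 / (suc i ℕ.^ k)) {{ℕP.m^n≢0 (suc i) k}}
  ≡⟨ cong (recip (suc i) *_) (1/[1+i]^k≡recip^k i k) ⟩
    recip (suc i) * recip (suc i) ^ k
  ∎
  where open ≡-Reasoning

term-pow : ∀ s k {m} → 1 ≤ m → term s k m ≡ sgn s m * recip m ^ k
term-pow s k {suc i} _ = cong (sgn s (suc i) *_) (1/[1+i]^k≡recip^k i k)

sign : Bool → ℚ
sign b = if b then - 1ℚ else 1ℚ

sign-xor : ∀ a b → sign (a xor b) ≡ sign a * sign b
sign-xor false false = refl
sign-xor false true  = refl
sign-xor true  false = refl
sign-xor true  true  = refl

sign-*-sign : ∀ b → sign b * sign b ≡ 1ℚ
sign-*-sign false = refl
sign-*-sign true  = refl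

∣sign∣ : ∀ b → ∣ sign b ∣ ≡ 1ℚ
∣sign∣ false = refl
∣sign∣ true  = refl

odd-+ : ∀ p q → odd (p ℕ.+ q) ≡ odd p xor odd q
odd-+ zero    q = refl
odd-+ (suc p) q = trans (cong not (odd-+ p q)) (𝔹P.not-distribˡ-xor (odd p) (odd q))

sgn-+ : ∀ s p q → sgn s (p ℕ.+ q) ≡ sgn s p * sgn s q
sgn-+ s p q = trans (cong (λ b → sign (s ∧ b)) (odd-+ p q))
  (trans (cong sign (𝔹P.∧-distribˡ-xor s (odd p) (odd q))) (sign-xor (s ∧ odd p) (s ∧ odd q)))

sgn-xor : ∀ s t m → sgn (s xor t) m ≡ sgn s m * sgn t m
sgn-xor s t m = trans (cong sign (𝔹P.∧-distribʳ-xor (odd m) s t)) (sign-xor (s ∧ odd m) (t ∧ odd m))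

sgn-*-sgn : ∀ s m → sgn s m * sgn s m ≡ 1ℚ
sgn-*-sgn s m = sign-*-sign (s ∧ odd m)

sgn-+-*-sgn-xorʳ : ∀ s₁ s₂ p q → sgn s₁ (p ℕ.+ q) * sgn (s₁ xor s₂) q ≡ sgn s₁ p * sgn s₂ q
sgn-+-*-sgn-xorʳ s₁ s₂ p q = begin
    sgn s₁ (p ℕ.+ q) * sgn (s₁ xor s₂) q
  ≡⟨ cong₂ _*_ (sgn-+ s₁ p q) (sgn-xor s₁ s₂ q) ⟩
    (sgn s₁ p * sgn s₁ q) * (sgn s₁ q * sgn s₂ q)
  ≡⟨ solve 3 (λ a b c → (a :* b) :* (b :* c) := a :* c :* (b :* b)) refl (sgn s₁ p) (sgn s₁ q) (sgn s₂ q) ⟩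
    sgn s₁ p * sgn s₂ q * (sgn s₁ q * sgn s₁ q)
  ≡⟨ trans (cong (sgn s₁ p * sgn s₂ q *_) (sgn-*-sgn s₁ q)) (ℚP.*-identityʳ _) ⟩
    sgn s₁ p * sgn s₂ q
  ∎
  where open ≡-Reasoning

sgn-+-*-sgn-xorˡ : ∀ s₁ s₂ p q → sgn s₂ (p ℕ.+ q) * sgn (s₁ xor s₂) p ≡ sgn s₁ p * sgn s₂ q
sgn-+-*-sgn-xorˡ s₁ s₂ p q = begin
    sgn s₂ (p ℕ.+ q) * sgn (s₁ xor s₂) p
  ≡⟨ cong₂ _*_ (sgn-+ s₂ p q) (sgn-xor s₁ s₂ p) ⟩
    (sgn s₂ p * sgn s₂ q) * (sgn s₁ p * sgn s₂ p)
  ≡⟨ solve 3 (λ a b c → (a :* b) :* (c :* a) := c :* b :* (a :* a)) refl (sgn s₂ p) (sgn s₂ q) (sgn s₁ p) ⟩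
    sgn s₁ p * sgn s₂ q * (sgn s₂ p * sgn s₂ p)
  ≡⟨ trans (cong (sgn s₁ p * sgn s₂ q *_) (sgn-*-sgn s₂ p)) (ℚP.*-identityʳ _) ⟩
    sgn s₁ p * sgn s₂ q
  ∎
  where open ≡-Reasoning

zeta2-triSum : ∀ N s₁ k₁ s₂ k₂ → zeta2 N s₁ k₁ s₂ k₂ ≡ triSum N (λ m n → term s₁ k₁ m * term s₂ k₂ n)
zeta2-triSum N s₁ k₁ s₂ k₂ = sym (sumTo-cong N (λ i _ → sumTo-*ˡ i (term s₁ k₁ (suc i)) (term s₂ k₂)))

-- The summands of the identities below, at a point m = p + q of a triangle sum,
-- written as a common sign times monomials in x = 1/p, y = 1/q and z = 1/m.
module AtSplit (s₁ s₂ : Bool) {m p q : ℕ} (m≡p+q : m ≡ p ℕ.+ q) (1≤p : 1 ≤ p) (1≤q : 1 ≤ q) where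

  σ = s₁ xor s₂
  x = recip p
  y = recip q
  z = recip m
  w = sgn s₁ p * sgn s₂ q

  1≤m : 1 ≤ m
  1≤m = subst (1 ≤_) (sym m≡p+q) (ℕP.≤-trans 1≤p (ℕP.m≤m+n p q))

  x+y≢0 : ¬ (x + y ≡ 0ℚ)
  x+y≢0 eq = ℚP.<⇒≢ (ℚP.+-mono-< (recip-pos 1≤p) (recip-pos 1≤q)) (sym eq)

  open PartialFractions x y z (trans (recip-+ 1≤p 1≤q) (cong (λ t → recip t * (x + y)) (sym m≡p+q))) public

  term-m-q : ∀ j e → term s₁ j m * term σ e q ≡ w * (z ^ j * y ^ e)
  term-m-q j e = begin
      term s₁ j m * term σ e q
    ≡⟨ cong₂ _*_ (term-pow s₁ j 1≤m) (term-pow σ e 1≤q) ⟩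
      sgn s₁ m * z ^ j * (sgn σ q * y ^ e)
    ≡⟨ interchange (sgn s₁ m) (z ^ j) (sgn σ q) (y ^ e) ⟩
      (sgn s₁ m * sgn σ q) * (z ^ j * y ^ e)
    ≡⟨ cong (λ t → (sgn s₁ t * sgn σ q) * (z ^ j * y ^ e)) m≡p+q ⟩
      (sgn s₁ (p ℕ.+ q) * sgn σ q) * (z ^ j * y ^ e)
    ≡⟨ cong (_* (z ^ j * y ^ e)) (sgn-+-*-sgn-xorʳ s₁ s₂ p q) ⟩
      w * (z ^ j * y ^ e)
    ∎
    where open ≡-Reasoning

  term-m-p : ∀ j e → term s₂ j m * term σ e p ≡ w * (z ^ j * x ^ e)
  term-m-p j e = begin
      term s₂ j m * term σ e p
    ≡⟨ cong₂ _*_ (term-pow s₂ j 1≤m) (term-pow σ e 1≤p) ⟩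
      sgn s₂ m * z ^ j * (sgn σ p * x ^ e)
    ≡⟨ interchange (sgn s₂ m) (z ^ j) (sgn σ p) (x ^ e) ⟩
      (sgn s₂ m * sgn σ p) * (z ^ j * x ^ e)
    ≡⟨ cong (λ t → (sgn s₂ t * sgn σ p) * (z ^ j * x ^ e)) m≡p+q ⟩
      (sgn s₂ (p ℕ.+ q) * sgn σ p) * (z ^ j * x ^ e)
    ≡⟨ cong (_* (z ^ j * x ^ e)) (sgn-+-*-sgn-xorˡ s₁ s₂ p q) ⟩
      w * (z ^ j * x ^ e)
    ∎
    where open ≡-Reasoning

  term-p-q : ∀ a b → term s₁ a p * term s₂ b q ≡ w * (x ^ a * y ^ b)
  term-p-q a b = trans (cong₂ _*_ (term-pow s₁ a 1≤p) (term-pow s₂ b 1≤q))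
    (interchange (sgn s₁ p) (x ^ a) (sgn s₂ q) (y ^ b))

module AtTriangle (s₁ s₂ : Bool) {m n : ℕ} (1≤n : 1 ≤ n) (n<m : n < m) =
  AtSplit s₁ s₂ (sym (ℕP.m∸n+n≡m (ℕP.<⇒≤ n<m))) (ℕP.m<n⇒0<n∸m n<m) 1≤n

sumTo-2^*zeta2≡2*sumTo-cauchy : ∀ N s₁ s₂ k →
  sumTo (k ∸ 1) (λ j → nat (2 ℕ.^ j) * (zeta2 N s₁ j (s₁ xor s₂) (k ∸ j) + zeta2 N s₂ j (s₁ xor s₂) (k ∸ j)))
  ≡ nat 2 * sumTo (k ∸ 1) (λ a → cauchy N (term s₁ a) (term s₂ (k ∸ a)))
sumTo-2^*zeta2≡2*sumTo-cauchy N s₁ s₂ k = begin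
    sumTo K (λ j → c j * (zeta2 N s₁ j σ (k ∸ j) + zeta2 N s₂ j σ (k ∸ j)))
  ≡⟨ sumTo-cong K (λ i _ → cong (c (suc i) *_) (cong₂ _+_ (zeta2-triSum N s₁ (suc i) σ (k ∸ suc i))
       (trans (zeta2-triSum N s₂ (suc i) σ (k ∸ suc i)) (sym (triSum-reflect N (G (suc i))))))) ⟩
    sumTo K (λ j → c j * (triSum N (F j) + triSum N (λ m n → G j m (m ∸ n))))
  ≡⟨ sumTo-cong K (λ i _ → sym (trans (triSum-*ˡ N (c (suc i)) _) (cong (c (suc i) *_) (triSum-+ N _ _)))) ⟩
    sumTo K (λ j → triSum N (λ m n → c j * (F j m n + G j m (m ∸ n))))
  ≡⟨ sumTo-triSum-comm K N _ ⟩
    triSum N (λ m n → sumTo K (λ j → c j * (F j m n + G j m (m ∸ n))))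
  ≡⟨ triSum-cong N (λ m n 1≤n n<m _ → weighted 1≤n n<m) ⟩
    triSum N (λ m n → nat 2 * W m n)
  ≡⟨ triSum-*ˡ N (nat 2) _ ⟩
    nat 2 * triSum N W
  ≡⟨ cong (nat 2 *_) (sym (trans (sumTo-triSum-comm K N _) (triSum-cong N (λ m n 1≤n n<m _ → mixed 1≤n n<m)))) ⟩
    nat 2 * sumTo K (λ a → cauchy N (term s₁ a) (term s₂ (k ∸ a)))
  ∎
  where
  open ≡-Reasoning
  K = k ∸ 1
  σ = s₁ xor s₂
  c : ℕ → ℚ
  c j = nat (2 ℕ.^ j)
  F G : ℕ → ℕ → ℕ → ℚ
  F j m n = term s₁ j m * term σ (k ∸ j) n
  G j m n = term s₂ j m * term σ (k ∸ j) n
  W : ℕ → ℕ → ℚ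
  W m n = sgn s₁ (m ∸ n) * sgn s₂ n * mixedSum (recip (m ∸ n)) (recip n) k
  weighted : ∀ {m n} → 1 ≤ n → n < m → sumTo K (λ j → c j * (F j m n + G j m (m ∸ n))) ≡ nat 2 * W m n
  weighted {m} {n} 1≤n n<m = begin
      sumTo K (λ j → c j * (F j m n + G j m (m ∸ n)))
    ≡⟨ sumTo-cong K (λ i _ → cong (c (suc i) *_)
         (cong₂ _+_ (P.term-m-q (suc i) (k ∸ suc i)) (P.term-m-p (suc i) (k ∸ suc i)))) ⟩
      sumTo K (λ j → c j * (P.w * (P.z ^ j * P.y ^ (k ∸ j)) + P.w * (P.z ^ j * P.x ^ (k ∸ j))))
    ≡⟨ sumTo-cong K (λ i _ →
         solve 5 (λ c w z y x → c :* (w :* (z :* y) :+ w :* (z :* x)) := w :* (c :* (z :* (y :+ x))))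
           refl (c (suc i)) P.w (P.z ^ suc i) (P.y ^ (k ∸ suc i)) (P.x ^ (k ∸ suc i))) ⟩
      sumTo K (λ j → P.w * (c j * (P.z ^ j * (P.y ^ (k ∸ j) + P.x ^ (k ∸ j)))))
    ≡⟨ sumTo-*ˡ K P.w _ ⟩
      P.w * weightedSum P.x P.y P.z k
    ≡⟨ cong (P.w *_) (P.weightedSum≡2*mixedSum P.x+y≢0 k) ⟩
      P.w * (nat 2 * mixedSum P.x P.y k)
    ≡⟨ solve 3 (λ w t l → w :* (t :* l) := t :* (w :* l)) refl P.w (nat 2) (mixedSum P.x P.y k) ⟩
      nat 2 * W m n
    ∎
    where module P = AtTriangle s₁ s₂ 1≤n n<m
  mixed : ∀ {m n} → 1 ≤ n → n < m → sumTo K (λ a → term s₁ a (m ∸ n) * term s₂ (k ∸ a) n) ≡ W m n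
  mixed 1≤n n<m = trans (sumTo-cong K (λ i _ → P.term-p-q (suc i) (k ∸ suc i))) (sumTo-*ˡ K P.w _)
    where module P = AtTriangle s₁ s₂ 1≤n n<m

sumTo-zeta2≡cauchy-∸-zeta2 : ∀ N s₁ s₂ K → sumTo K (λ j → zeta2 N s₁ j (s₁ xor s₂) (suc K ∸ j))
                              ≡ cauchy N (term s₁ 1) (term s₂ K) - zeta2 N s₂ K (s₁ xor s₂) 1
sumTo-zeta2≡cauchy-∸-zeta2 N s₁ s₂ K = begin
    sumTo K (λ j → zeta2 N s₁ j σ (suc K ∸ j))
  ≡⟨ sumTo-cong K (λ i _ → zeta2-triSum N s₁ (suc i) σ (suc K ∸ suc i)) ⟩
    sumTo K (λ j → triSum N (λ m n → term s₁ j m * term σ (suc K ∸ j) n))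
  ≡⟨ sumTo-triSum-comm K N _ ⟩
    triSum N (λ m n → sumTo K (λ j → term s₁ j m * term σ (suc K ∸ j) n))
  ≡⟨ triSum-cong N (λ m n 1≤n n<m _ → closedForm 1≤n n<m) ⟩
    triSum N (λ m n → term s₁ 1 (m ∸ n) * term s₂ K n - term s₂ K m * term σ 1 (m ∸ n))
  ≡⟨ triSum-- N _ _ ⟩
    cauchy N (term s₁ 1) (term s₂ K) - triSum N (λ m n → term s₂ K m * term σ 1 (m ∸ n))
  ≡⟨ cong (λ t → cauchy N (term s₁ 1) (term s₂ K) - t)
       (trans (triSum-reflect N (λ m n → term s₂ K m * term σ 1 n)) (sym (zeta2-triSum N s₂ K σ 1))) ⟩
    cauchy N (term s₁ 1) (term s₂ K) - zeta2 N s₂ K σ 1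
  ∎
  where
  open ≡-Reasoning
  σ = s₁ xor s₂
  closedForm : ∀ {m n} → 1 ≤ n → n < m → sumTo K (λ j → term s₁ j m * term σ (suc K ∸ j) n)
               ≡ term s₁ 1 (m ∸ n) * term s₂ K n - term s₂ K m * term σ 1 (m ∸ n)
  closedForm {m} {n} 1≤n n<m = begin
      sumTo K (λ j → term s₁ j m * term σ (suc K ∸ j) n)
    ≡⟨ sumTo-cong K (λ i _ → P.term-m-q (suc i) (suc K ∸ suc i)) ⟩
      sumTo K (λ j → P.w * (P.z ^ j * P.y ^ (suc K ∸ j)))
    ≡⟨ sumTo-*ˡ K P.w _ ⟩
      P.w * zySum P.y P.z (suc K)
    ≡⟨ cong (P.w *_) (P.zySum-closed K) ⟩
      P.w * (P.x * (P.y ^ K - P.z ^ K))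
    ≡⟨ solve 4 (λ w x Y Z → w :* (x :* (Y :- Z)) := w :* (x :* con 1ℚ :* Y) :- w :* (Z :* (x :* con 1ℚ)))
         refl P.w P.x (P.y ^ K) (P.z ^ K) ⟩
      P.w * (P.x ^ 1 * P.y ^ K) - P.w * (P.z ^ K * P.x ^ 1)
    ≡⟨ cong₂ _-_ (P.term-p-q 1 K) (P.term-m-p K 1) ⟨
      term s₁ 1 (m ∸ n) * term s₂ K n - term s₂ K m * term σ 1 (m ∸ n)
    ∎
    where module P = AtTriangle s₁ s₂ 1≤n n<m

zeta1-*-zeta1 : ∀ N s₁ a s₂ b → zeta1 N s₁ a * zeta1 N s₂ b ≡
                zeta2 N s₁ a s₂ b + zeta2 N s₂ b s₁ a + zeta1 N (s₁ xor s₂) (a ℕ.+ b)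
zeta1-*-zeta1 N s₁ a s₂ b = trans (stuffle N (term s₁ a) (term s₂ b))
  (cong₂ _+_ (cong₂ _+_ (sym (zeta2-triSum N s₁ a s₂ b)) (sym (zeta2-triSum N s₂ b s₁ a)))
             (sumTo-cong N (λ i _ → diagonal (s≤s z≤n))))
  where
  diagonal : ∀ {m} → 1 ≤ m → term s₁ a m * term s₂ b m ≡ term (s₁ xor s₂) (a ℕ.+ b) m
  diagonal {m} 1≤m = begin
      term s₁ a m * term s₂ b m
    ≡⟨ cong₂ _*_ (term-pow s₁ a 1≤m) (term-pow s₂ b 1≤m) ⟩
      sgn s₁ m * recip m ^ a * (sgn s₂ m * recip m ^ b)
    ≡⟨ interchange (sgn s₁ m) (recip m ^ a) (sgn s₂ m) (recip m ^ b) ⟩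
      (sgn s₁ m * sgn s₂ m) * (recip m ^ a * recip m ^ b)
    ≡⟨ cong₂ _*_ (sgn-xor s₁ s₂ m) (^-homo-* (recip m) a b) ⟨
      sgn (s₁ xor s₂) m * recip m ^ (a ℕ.+ b)
    ≡⟨ term-pow (s₁ xor s₂) (a ℕ.+ b) 1≤m ⟨
      term (s₁ xor s₂) (a ℕ.+ b) m
    ∎
    where open ≡-Reasoning

-- The defect of the Cauchy product

m*n≤m*m+n*n : ∀ m n → m ℕ.* n ≤ m ℕ.* m ℕ.+ n ℕ.* n
m*n≤m*m+n*n m n with ℕP.≤-total m n
... | inj₁ m≤n = ℕP.≤-trans (ℕP.*-monoˡ-≤ n m≤n) (ℕP.m≤n+m (n ℕ.* n) (m ℕ.* m))
... | inj₂ n≤m = ℕP.≤-trans (ℕP.*-monoʳ-≤ m n≤m) (ℕP.m≤m+n (m ℕ.* m) (n ℕ.* n))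

p²q-weight-bound : ∀ {N p q} A → N ≤ p ℕ.+ q → p ℕ.* p ℕ.* q ≤ A →
                   N ℕ.* (p ℕ.* p ℕ.* (q ℕ.* q)) ≤ 2 ℕ.* (p ℕ.* p ℕ.+ q ℕ.* q) ℕ.* A
p²q-weight-bound {N} {p} {q} A N≤p+q p²q≤A = begin
    N ℕ.* (p ℕ.* p ℕ.* (q ℕ.* q))
  ≤⟨ ℕP.*-monoˡ-≤ (p ℕ.* p ℕ.* (q ℕ.* q)) N≤p+q ⟩
    (p ℕ.+ q) ℕ.* (p ℕ.* p ℕ.* (q ℕ.* q))
  ≡⟨ ℕ-Ring.solve (p ∷ q ∷ []) ⟩
    (p ℕ.* q ℕ.+ q ℕ.* q) ℕ.* (p ℕ.* p ℕ.* q)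
  ≤⟨ ℕP.*-mono-≤ (ℕP.+-monoˡ-≤ (q ℕ.* q) (m*n≤m*m+n*n p q)) p²q≤A ⟩
    (p ℕ.* p ℕ.+ q ℕ.* q ℕ.+ q ℕ.* q) ℕ.* A
  ≤⟨ ℕP.*-monoˡ-≤ A (ℕP.m≤m+n (p ℕ.* p ℕ.+ q ℕ.* q ℕ.+ q ℕ.* q) (p ℕ.* p)) ⟩
    (p ℕ.* p ℕ.+ q ℕ.* q ℕ.+ q ℕ.* q ℕ.+ p ℕ.* p) ℕ.* A
  ≡⟨ ℕ-Ring.solve (p ∷ q ∷ A ∷ []) ⟩
    2 ℕ.* (p ℕ.* p ℕ.+ q ℕ.* q) ℕ.* A
  ∎
  where open ℕP.≤-Reasoning

-- One of the exponents is at least 2, so p^a q^b ≥ p²q or pq², and p + q ≥ N does the rest.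
weight-bound : ∀ {N p q} a b .{{_ : ℕ.NonZero p}} .{{_ : ℕ.NonZero q}} →
               1 ≤ a → 1 ≤ b → 3 ≤ a ℕ.+ b → N ≤ p ℕ.+ q →
               N ℕ.* (p ℕ.* p ℕ.* (q ℕ.* q)) ≤ 2 ℕ.* (p ℕ.* p ℕ.+ q ℕ.* q) ℕ.* (p ℕ.^ a ℕ.* q ℕ.^ b)
weight-bound {N} {p} {q} (suc (suc a)) b _ 1≤b _ N≤p+q =
  p²q-weight-bound {N} {p} {q} (p ℕ.^ suc (suc a) ℕ.* q ℕ.^ b) N≤p+q
  (ℕP.*-mono-≤ (ℕP.≤-trans (ℕP.≤-reflexive (cong (p ℕ.*_) (sym (ℕP.^-identityʳ p))))
                           (ℕP.^-monoʳ-≤ p {2} {suc (suc a)} (s≤s (s≤s z≤n))))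
               (ℕP.≤-trans (ℕP.≤-reflexive (sym (ℕP.^-identityʳ q))) (ℕP.^-monoʳ-≤ q 1≤b)))
weight-bound {N} {p} {q} (suc zero) b _ _ 2≤1+b N≤p+q = begin
    N ℕ.* (p ℕ.* p ℕ.* (q ℕ.* q))
  ≡⟨ cong (N ℕ.*_) (ℕP.*-comm (p ℕ.* p) (q ℕ.* q)) ⟩
    N ℕ.* (q ℕ.* q ℕ.* (p ℕ.* p))
  ≤⟨ p²q-weight-bound {N} {q} {p} (q ℕ.^ b ℕ.* p ℕ.^ 1) (ℕP.≤-trans N≤p+q (ℕP.≤-reflexive (ℕP.+-comm p q)))
       (ℕP.≤-trans (ℕP.≤-reflexive (cong (λ t → q ℕ.* t ℕ.* p) (sym (ℕP.^-identityʳ q))))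
          (ℕP.*-mono-≤ (ℕP.^-monoʳ-≤ q {2} {b} (ℕP.+-cancelˡ-≤ 1 2 b 2≤1+b))
                       (ℕP.≤-reflexive (sym (ℕP.^-identityʳ p))))) ⟩
    2 ℕ.* (q ℕ.* q ℕ.+ p ℕ.* p) ℕ.* (q ℕ.^ b ℕ.* p ℕ.^ 1)
  ≡⟨ cong₂ (λ s t → 2 ℕ.* s ℕ.* t) (ℕP.+-comm (q ℕ.* q) (p ℕ.* p)) (ℕP.*-comm (q ℕ.^ b) (p ℕ.^ 1)) ⟩
    2 ℕ.* (p ℕ.* p ℕ.+ q ℕ.* q) ℕ.* (p ℕ.^ 1 ℕ.* q ℕ.^ b)
  ∎
  where open ℕP.≤-Reasoning

recip²-bound : ∀ N P Q a b → 1 ≤ a → 1 ≤ b → 3 ≤ a ℕ.+ b → suc N ≤ suc P ℕ.+ suc Q →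
  recip (suc P) ^ a * recip (suc Q) ^ b ℚ.≤ nat 2 * recip (suc N) * (recip (suc P) ^ 2 + recip (suc Q) ^ 2)
recip²-bound N P Q a b 1≤a 1≤b 3≤a+b N<p+q = begin
    recip p ^ a * recip q ^ b
  ≡⟨ cong₂ _*_ (1/[1+i]^k≡recip^k P a) (1/[1+i]^k≡recip^k Q b) ⟨
    (ℤ.+ 1 / p ℕ.^ a) {{p^a≢0}} * (ℤ.+ 1 / q ℕ.^ b) {{q^b≢0}}
  ≡⟨ frac-* 1 (p ℕ.^ a) 1 (q ℕ.^ b) {{p^a≢0}} {{q^b≢0}} ⟩
    (ℤ.+ 1 / (p ℕ.^ a ℕ.* q ℕ.^ b)) {{p^aq^b≢0}}
  ≤⟨ frac-≤ 1 (p ℕ.^ a ℕ.* q ℕ.^ b) (2 ℕ.* (p ℕ.* p ℕ.+ q ℕ.* q)) (suc N ℕ.* (p ℕ.* p ℕ.* (q ℕ.* q)))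
       {{p^aq^b≢0}} (ℕP.≤-trans (ℕP.≤-reflexive (ℕP.*-identityˡ _)) (weight-bound a b 1≤a 1≤b 3≤a+b N<p+q)) ⟩
    ℤ.+ (2 ℕ.* (p ℕ.* p ℕ.+ q ℕ.* q)) / (suc N ℕ.* (p ℕ.* p ℕ.* (q ℕ.* q)))
  ≡⟨ frac-cong (2 ℕ.* (p ℕ.* p ℕ.+ q ℕ.* q)) (suc N ℕ.* (p ℕ.* p ℕ.* (q ℕ.* q)))
       (2 ℕ.* 1 ℕ.* (1 ℕ.* (q ℕ.* q) ℕ.+ 1 ℕ.* (p ℕ.* p))) (1 ℕ.* suc N ℕ.* (p ℕ.* p ℕ.* (q ℕ.* q)))
       (normalise (suc N) p q) ⟩
    ℤ.+ (2 ℕ.* 1 ℕ.* (1 ℕ.* (q ℕ.* q) ℕ.+ 1 ℕ.* (p ℕ.* p))) / (1 ℕ.* suc N ℕ.* (p ℕ.* p ℕ.* (q ℕ.* q)))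
  ≡⟨ frac-* (2 ℕ.* 1) (1 ℕ.* suc N) (1 ℕ.* (q ℕ.* q) ℕ.+ 1 ℕ.* (p ℕ.* p)) (p ℕ.* p ℕ.* (q ℕ.* q)) ⟨
    (ℤ.+ (2 ℕ.* 1) / (1 ℕ.* suc N)) * (ℤ.+ (1 ℕ.* (q ℕ.* q) ℕ.+ 1 ℕ.* (p ℕ.* p)) / (p ℕ.* p ℕ.* (q ℕ.* q)))
  ≡⟨ cong₂ _*_ (frac-* 2 1 1 (suc N)) (frac-+ 1 (p ℕ.* p) 1 (q ℕ.* q)) ⟨
    nat 2 * recip (suc N) * (ℤ.+ 1 / (p ℕ.* p) + ℤ.+ 1 / (q ℕ.* q))
  ≡⟨ cong (λ t → nat 2 * recip (suc N) * t) (cong₂ _+_ (recip² P) (recip² Q)) ⟩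
    nat 2 * recip (suc N) * (recip p ^ 2 + recip q ^ 2)
  ∎
  where
  open ℚP.≤-Reasoning
  p = suc P
  q = suc Q
  p^a≢0 = ℕP.m^n≢0 p a
  q^b≢0 = ℕP.m^n≢0 q b
  p^aq^b≢0 = ℕP.m*n≢0 (p ℕ.^ a) (q ℕ.^ b) {{p^a≢0}} {{q^b≢0}}
  normalise : ∀ n p q → 2 ℕ.* (p ℕ.* p ℕ.+ q ℕ.* q) ℕ.* (1 ℕ.* n ℕ.* (p ℕ.* p ℕ.* (q ℕ.* q)))
              ≡ 2 ℕ.* 1 ℕ.* (1 ℕ.* (q ℕ.* q) ℕ.+ 1 ℕ.* (p ℕ.* p)) ℕ.* (n ℕ.* (p ℕ.* p ℕ.* (q ℕ.* q)))
  normalise = ℕ-Ring.solve-∀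
  recip² : ∀ n → ℤ.+ 1 / (suc n ℕ.* suc n) ≡ recip (suc n) ^ 2
  recip² n = trans (sym (frac-* 1 (suc n) 1 (suc n)))
                         (cong (recip (suc n) *_) (sym (ℚP.*-identityʳ (recip (suc n)))))

∣term∣ : ∀ s k i → ∣ term s k (suc i) ∣ ≡ recip (suc i) ^ k
∣term∣ s k i = begin
    ∣ sgn s (suc i) * u ∣
  ≡⟨ ℚP.∣p*q∣≡∣p∣*∣q∣ (sgn s (suc i)) u ⟩
    ∣ sgn s (suc i) ∣ * ∣ u ∣
  ≡⟨ cong₂ _*_ (∣sign∣ (s ∧ odd (suc i))) (ℚP.0≤p⇒∣p∣≡p (frac-≤ 0 1 1 (suc i ℕ.^ k) {{_}} {{u≢0}} z≤n)) ⟩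
    1ℚ * u
  ≡⟨ trans (ℚP.*-identityˡ u) (1/[1+i]^k≡recip^k i k) ⟩
    recip (suc i) ^ k
  ∎
  where
  open ≡-Reasoning
  u≢0 = ℕP.m^n≢0 (suc i) k
  u = (ℤ.+ 1 / (suc i ℕ.^ k)) {{u≢0}}

nat-*-recip^2 : ∀ p → nat p * recip p ^ 2 ≡ recip p
nat-*-recip^2 zero    = refl
nat-*-recip^2 (suc P) = begin
    nat p * (recip p * (recip p * 1ℚ))
  ≡⟨ cong (λ t → nat p * (recip p * t)) (ℚP.*-identityʳ (recip p)) ⟩
    nat p * (recip p * recip p)
  ≡⟨ cong (nat p *_) (frac-* 1 p 1 p) ⟩
    nat p * (ℤ.+ 1 / (p ℕ.* p))
  ≡⟨ frac-* p 1 1 (p ℕ.* p) ⟩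
    ℤ.+ (p ℕ.* 1) / (1 ℕ.* (p ℕ.* p))
  ≡⟨ frac-cong (p ℕ.* 1) (1 ℕ.* (p ℕ.* p)) 1 p (normalise p) ⟩
    recip p
  ∎
  where
  open ≡-Reasoning
  p = suc P
  normalise : ∀ p → p ℕ.* 1 ℕ.* p ≡ 1 ℕ.* (1 ℕ.* (p ℕ.* p))
  normalise = ℕ-Ring.solve-∀

sumTo-tails : ∀ N (G : ℕ → ℚ) →
              sumTo N (λ p → sumTo p (λ i → G (N ∸ p ℕ.+ i))) ≡ sumTo N (λ q → nat q * G q)
sumTo-tails zero    G = refl
sumTo-tails (suc N) G = begin
    sumTo N (λ p → sumTo p (λ i → G (suc N ∸ p ℕ.+ i))) + sumTo (suc N) (λ i → G (suc N ∸ suc N ℕ.+ i))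
  ≡⟨ cong₂ _+_ (sumTo-cong N (λ j j<N → sumTo-cong (suc j) (λ i _ →
                  cong (λ t → G (t ℕ.+ suc i)) (ℕP.+-∸-assoc 1 j<N))))
               (sumTo-cong (suc N) (λ i _ → cong (λ t → G (t ℕ.+ suc i)) (ℕP.n∸n≡0 N))) ⟩
    sumTo N (λ p → sumTo p (λ i → G (suc (N ∸ p ℕ.+ i)))) + sumTo (suc N) G
  ≡⟨ cong₂ _+_ (sumTo-tails N (λ q → G (suc q))) (sumTo-unfoldˡ N G) ⟩
    sumTo N (λ q → nat q * G (suc q)) + (G 1 + sumTo N (λ q → G (suc q)))
  ≡⟨ solve 3 (λ a g b → a :+ (g :+ b) := g :+ (a :+ b)) refl
       (sumTo N (λ q → nat q * G (suc q))) (G 1) (sumTo N (λ q → G (suc q))) ⟩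
    G 1 + (sumTo N (λ q → nat q * G (suc q)) + sumTo N (λ q → G (suc q)))
  ≡⟨ cong₂ _+_ (sym (ℚP.*-identityˡ (G 1)))
       (trans (sym (sumTo-+ N _ _)) (sumTo-cong N (λ i _ → sym (nat-suc-* (suc i) (G (suc (suc i))))))) ⟩
    1ℚ * G 1 + sumTo N (λ q → nat (suc q) * G (suc q))
  ≡⟨ sumTo-unfoldˡ N (λ q → nat q * G q) ⟨
    sumTo (suc N) (λ q → nat q * G q)
  ∎
  where open ≡-Reasoning

harmonic : ℕ → ℚ
harmonic N = sumTo N recip

errorBound : ℕ → ℚ
errorBound N = nat 2 * recip (suc N) * (harmonic N + harmonic N)

cauchyError : ℕ → Bool → ℕ → Bool → ℕ → ℚ
cauchyError N s₁ a s₂ b = zeta1 N s₁ a * zeta1 N s₂ b - cauchy N (term s₁ a) (term s₂ b)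

tail-index-bound : ∀ {N P} → P < N → ∀ j → suc N ≤ suc P ℕ.+ suc (N ∸ suc P ℕ.+ j)
tail-index-bound {N} {P} P<N j = begin
    suc N
  ≡⟨ cong suc (ℕP.m∸n+n≡m P<N) ⟨
    suc (N ∸ suc P ℕ.+ suc P)
  ≤⟨ s≤s (ℕP.m≤m+n _ j) ⟩
    suc (N ∸ suc P ℕ.+ suc P ℕ.+ j)
  ≡⟨ rearrange (N ∸ suc P) P j ⟩
    suc P ℕ.+ suc (N ∸ suc P ℕ.+ j)
  ∎
  where
  open ℕP.≤-Reasoning
  rearrange : ∀ x p j → suc (x ℕ.+ suc p ℕ.+ j) ≡ suc p ℕ.+ suc (x ℕ.+ j)
  rearrange = ℕ-Ring.solve-∀

-- The defect of the Cauchy product consists of the terms with p, q ≤ N < p + q; each is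
-- at most 2/(N+1) · (1/p² + 1/q²), and each p occurs at most p times.
∣cauchyError∣≤errorBound : ∀ N s₁ a s₂ b → 1 ≤ a → 1 ≤ b → 3 ≤ a ℕ.+ b →
                           ∣ cauchyError N s₁ a s₂ b ∣ ℚ.≤ errorBound N
∣cauchyError∣≤errorBound N s₁ a s₂ b 1≤a 1≤b 3≤a+b = begin
    ∣ cauchyError N s₁ a s₂ b ∣
  ≡⟨ cong ∣_∣ (sumTo-*-sumTo-∸-cauchy N (term s₁ a) (term s₂ b)) ⟩
    ∣ sumTo N (λ p → term s₁ a p * tail p) ∣
  ≤⟨ ∣sumTo∣≤sumTo∣∣ N _ ⟩
    sumTo N (λ p → ∣ term s₁ a p * tail p ∣)
  ≤⟨ sumTo-mono-≤ N (λ P P<N → ∣term*tail∣≤ P<N) ⟩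
    sumTo N (λ p → sumTo p (λ _ → c * V p) + sumTo p (λ i → c * V (N ∸ p ℕ.+ i)))
  ≡⟨ sumTo-+ N _ _ ⟩
    sumTo N (λ p → sumTo p (λ _ → c * V p)) + sumTo N (λ p → sumTo p (λ i → c * V (N ∸ p ℕ.+ i)))
  ≡⟨ cong₂ _+_ (sumTo-cong N (λ i _ → sumTo-const (suc i) (c * V (suc i)))) (sumTo-tails N (λ q → c * V q)) ⟩
    sumTo N (λ q → nat q * (c * V q)) + sumTo N (λ q → nat q * (c * V q))
  ≡⟨ cong (λ t → t + t) (trans (sumTo-cong N (λ i _ →
       trans (solve 3 (λ n c v → n :* (c :* v) := c :* (n :* v)) refl (nat (suc i)) c (V (suc i)))
             (cong (c *_) (nat-*-recip^2 (suc i))))) (sumTo-*ˡ N c recip)) ⟩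
    c * harmonic N + c * harmonic N
  ≡⟨ ℚP.*-distribˡ-+ c (harmonic N) (harmonic N) ⟨
    errorBound N
  ∎
  where
  open ℚP.≤-Reasoning
  c = nat 2 * recip (suc N)
  V : ℕ → ℚ
  V p = recip p ^ 2
  tail : ℕ → ℚ
  tail p = sumTo p (λ i → term s₂ b (N ∸ p ℕ.+ i))
  ∣term*tail∣≤ : ∀ {P} → P < N → ∣ term s₁ a (suc P) * tail (suc P) ∣ ℚ.≤
                 sumTo (suc P) (λ _ → c * V (suc P)) + sumTo (suc P) (λ i → c * V (N ∸ suc P ℕ.+ i))
  ∣term*tail∣≤ {P} P<N = begin
      ∣ term s₁ a (suc P) * tail (suc P) ∣
    ≡⟨ ℚP.∣p*q∣≡∣p∣*∣q∣ (term s₁ a (suc P)) (tail (suc P)) ⟩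
      ∣ term s₁ a (suc P) ∣ * ∣ tail (suc P) ∣
    ≡⟨ cong (_* ∣ tail (suc P) ∣) (∣term∣ s₁ a P) ⟩
      u * ∣ tail (suc P) ∣
    ≤⟨ ℚP.*-monoˡ-≤-nonNeg u {{ℚ.nonNegative (^-nonNeg a (recip-nonNeg (suc P)))}}
         (∣sumTo∣≤sumTo∣∣ (suc P) _) ⟩
      u * sumTo (suc P) (λ i → ∣ term s₂ b (N ∸ suc P ℕ.+ i) ∣)
    ≡⟨ sumTo-*ˡ (suc P) u _ ⟨
      sumTo (suc P) (λ i → u * ∣ term s₂ b (N ∸ suc P ℕ.+ i) ∣)
    ≤⟨ sumTo-mono-≤ (suc P) (λ j _ → begin
         u * ∣ term s₂ b (N ∸ suc P ℕ.+ suc j) ∣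
       ≡⟨ cong (λ t → u * ∣ term s₂ b t ∣) (ℕP.+-suc (N ∸ suc P) j) ⟩
         u * ∣ term s₂ b (suc (N ∸ suc P ℕ.+ j)) ∣
       ≡⟨ cong (u *_) (∣term∣ s₂ b (N ∸ suc P ℕ.+ j)) ⟩
         u * recip (suc (N ∸ suc P ℕ.+ j)) ^ b
       ≤⟨ recip²-bound N P (N ∸ suc P ℕ.+ j) a b 1≤a 1≤b 3≤a+b (tail-index-bound P<N j) ⟩
         c * (V (suc P) + V (suc (N ∸ suc P ℕ.+ j)))
       ≡⟨ cong (λ t → c * (V (suc P) + V t)) (ℕP.+-suc (N ∸ suc P) j) ⟨
         c * (V (suc P) + V (N ∸ suc P ℕ.+ suc j))
       ∎) ⟩
      sumTo (suc P) (λ i → c * (V (suc P) + V (N ∸ suc P ℕ.+ i)))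
    ≡⟨ trans (sumTo-cong (suc P) (λ i _ → ℚP.*-distribˡ-+ c _ _)) (sumTo-+ (suc P) _ _) ⟩
      sumTo (suc P) (λ _ → c * V (suc P)) + sumTo (suc P) (λ i → c * V (N ∸ suc P ℕ.+ i))
    ∎
    where
    u = recip (suc P) ^ a

-- Convergence

harmonic≤nat : ∀ M → harmonic M ℚ.≤ nat M
harmonic≤nat zero    = ℚP.≤-refl
harmonic≤nat (suc M) = ℚP.≤-trans (ℚP.+-mono-≤ (harmonic≤nat M) (frac-≤ 1 (suc M) 1 1 (s≤s z≤n)))
                                  (ℚP.≤-reflexive (sym (nat-suc M)))

harmonic-+ : ∀ M d → harmonic (M ℕ.+ d) ℚ.≤ nat M + nat d * recip (suc M)
harmonic-+ M zero    = begin
    harmonic (M ℕ.+ 0)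
  ≡⟨ cong harmonic (ℕP.+-identityʳ M) ⟩
    harmonic M
  ≤⟨ harmonic≤nat M ⟩
    nat M
  ≡⟨ ℚP.+-identityʳ (nat M) ⟨
    nat M + 0ℚ
  ≡⟨ cong (nat M +_) (ℚP.*-zeroˡ (recip (suc M))) ⟨
    nat M + nat 0 * recip (suc M)
  ∎
  where open ℚP.≤-Reasoning
harmonic-+ M (suc d) = begin
    harmonic (M ℕ.+ suc d)
  ≡⟨ cong harmonic (ℕP.+-suc M d) ⟩
    harmonic (M ℕ.+ d) + recip (suc (M ℕ.+ d))
  ≤⟨ ℚP.+-mono-≤ (harmonic-+ M d)
       (frac-≤ 1 (suc (M ℕ.+ d)) 1 (suc M) (ℕP.*-monoʳ-≤ 1 (s≤s (ℕP.m≤m+n M d)))) ⟩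
    nat M + nat d * recip (suc M) + recip (suc M)
  ≡⟨ solve 3 (λ m d r → m :+ d :* r :+ r := m :+ (d :+ con 1ℚ) :* r) refl (nat M) (nat d) (recip (suc M)) ⟩
    nat M + (nat d + 1ℚ) * recip (suc M)
  ≡⟨ cong (λ t → nat M + t * recip (suc M)) (nat-suc d) ⟨
    nat M + nat (suc d) * recip (suc M)
  ∎
  where open ℚP.≤-Reasoning

nat-*-recip≤1 : ∀ {d N} → d ≤ N → nat d * recip (suc N) ℚ.≤ 1ℚ
nat-*-recip≤1 {d} {N} d≤N = ℚP.≤-trans (ℚP.≤-reflexive (frac-* d 1 1 (suc N)))
  (frac-≤ (d ℕ.* 1) (1 ℕ.* suc N) 1 1
    (ℕP.≤-trans (ℕP.≤-reflexive (ℕP.*-identityʳ (d ℕ.* 1)))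
    (ℕP.≤-trans (ℕP.≤-reflexive (ℕP.*-identityʳ d))
    (ℕP.≤-trans (ℕP.m≤n⇒m≤1+n d≤N) (ℕP.≤-reflexive (sym (ℕ-Ring.solve (N ∷ []))))))))

nat-*-recip<recip : ∀ K n t → K ℕ.* suc t < suc n → nat K * recip (suc n) ℚ.< recip (suc t)
nat-*-recip<recip K n t Kt<n = ℚP.≤-<-trans (ℚP.≤-reflexive (frac-* K 1 1 (suc n)))
  (frac-< (K ℕ.* 1) (1 ℕ.* suc n) 1 (suc t)
    (subst₂ _<_ (cong (ℕ._* suc t) (sym (ℕP.*-identityʳ K)))
                (sym (trans (ℕP.*-identityˡ _) (ℕP.*-identityˡ (suc n)))) Kt<n))

recip+recip≤ : ∀ {ε} → 0ℚ ℚ.< ε → Σ ℕ λ t → recip (suc t) + recip (suc t) ℚ.≤ ε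
recip+recip≤ {mkℚ (ℤ.+ 0)       _  _} (ℚ.*<* (ℤ.+<+ ()))
recip+recip≤ {mkℚ ℤ.-[1+ _ ]    _  _} (ℚ.*<* ())
recip+recip≤ {ε@(mkℚ (ℤ.+ suc e) d _)} _ = d ℕ.+ suc d , (begin
    recip (suc d ℕ.+ suc d) + recip (suc d ℕ.+ suc d)
  ≡⟨ frac-+ 1 (suc d ℕ.+ suc d) 1 (suc d ℕ.+ suc d) ⟩
    ℤ.+ (1 ℕ.* (suc d ℕ.+ suc d) ℕ.+ 1 ℕ.* (suc d ℕ.+ suc d)) / ((suc d ℕ.+ suc d) ℕ.* (suc d ℕ.+ suc d))
  ≡⟨ frac-cong (1 ℕ.* (suc d ℕ.+ suc d) ℕ.+ 1 ℕ.* (suc d ℕ.+ suc d)) ((suc d ℕ.+ suc d) ℕ.* (suc d ℕ.+ suc d))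
       1 (suc d) (double (suc d)) ⟩
    ℤ.+ 1 / suc d
  ≤⟨ frac-≤ 1 (suc d) (suc e) (suc d) (ℕP.*-monoˡ-≤ (suc d) {1} {suc e} (s≤s z≤n)) ⟩
    ℤ.+ suc e / suc d
  ≡⟨ ℚP.↥p/↧p≡p ε ⟩
    ε
  ∎)
  where
  open ℚP.≤-Reasoning
  double : ∀ t → (1 ℕ.* (t ℕ.+ t) ℕ.+ 1 ℕ.* (t ℕ.+ t)) ℕ.* t ≡ 1 ℕ.* ((t ℕ.+ t) ℕ.* (t ℕ.+ t))
  double = ℕ-Ring.solve-∀

-- Splitting N = M + d: the harmonic sum up to M is at most M, and the d further terms
-- are each at most 1/(M+1).
nat-*-errorBound≤ : ∀ C M d → nat C * errorBound (M ℕ.+ d) ℚ.≤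
  nat (C ℕ.* 2 ℕ.* 2 ℕ.* M) * recip (suc (M ℕ.+ d)) + nat (C ℕ.* 2 ℕ.* 2) * recip (suc M)
nat-*-errorBound≤ C M d = begin
    nat C * (nat 2 * r * (harmonic N + harmonic N))
  ≡⟨ ℚP.*-assoc (nat C) _ _ ⟨
    nat C * (nat 2 * r) * (harmonic N + harmonic N)
  ≤⟨ ℚP.*-monoˡ-≤-nonNeg (nat C * (nat 2 * r)) {{ℚ.nonNegative 0≤C2r}}
       (ℚP.+-mono-≤ (harmonic-+ M d) (harmonic-+ M d)) ⟩
    nat C * (nat 2 * r) * (Y + Y)
  ≡⟨ solve 6 (λ C t rN m d rM → C :* (t :* rN) :* ((m :+ d :* rM) :+ (m :+ d :* rM)) :=
                  (C :* t :* con (nat 2) :* m) :* rN :+ (C :* t :* con (nat 2)) :* (d :* rN) :* rM)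
       refl (nat C) (nat 2) r (nat M) (nat d) (recip (suc M)) ⟩
    K * nat M * r + K * (nat d * r) * recip (suc M)
  ≤⟨ ℚP.+-monoʳ-≤ (K * nat M * r) (ℚP.*-monoʳ-≤-nonNeg (recip (suc M)) {{ℚ.nonNegative (recip-nonNeg (suc M))}}
       (ℚP.≤-trans (ℚP.*-monoˡ-≤-nonNeg K {{ℚ.nonNegative 0≤K}} (nat-*-recip≤1 (ℕP.m≤n+m d M)))
                   (ℚP.≤-reflexive (ℚP.*-identityʳ K)))) ⟩
    K * nat M * r + K * recip (suc M)
  ≡⟨ cong₂ (λ a b → a * r + b * recip (suc M)) (trans (cong (_* nat M) K≡) (sym (nat-* (C ℕ.* 2 ℕ.* 2) M))) K≡ ⟩
    nat (C ℕ.* 2 ℕ.* 2 ℕ.* M) * r + nat (C ℕ.* 2 ℕ.* 2) * recip (suc M)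
  ∎
  where
  open ℚP.≤-Reasoning
  N = M ℕ.+ d
  r = recip (suc N)
  Y = nat M + nat d * recip (suc M)
  K = nat C * nat 2 * nat 2
  K≡ : K ≡ nat (C ℕ.* 2 ℕ.* 2)
  K≡ = trans (cong (_* nat 2) (sym (nat-* C 2))) (sym (nat-* (C ℕ.* 2) 2))
  0≤K : 0ℚ ℚ.≤ K
  0≤K = *-nonNeg (*-nonNeg (nat-nonNeg C) (nat-nonNeg 2)) (nat-nonNeg 2)
  0≤C2r : 0ℚ ℚ.≤ nat C * (nat 2 * r)
  0≤C2r = *-nonNeg (nat-nonNeg C) (*-nonNeg (nat-nonNeg 2) (recip-nonNeg (suc N)))

tendsToZero-≤-errorBound : ∀ {x d : ℕ → ℚ} C → (∀ N → x N ≡ d N) →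
                           (∀ N → ∣ d N ∣ ℚ.≤ nat C * errorBound N) → TendsToZero x
tendsToZero-≤-errorBound {x} {d} C x≡d ∣d∣≤ ε 0<ε with recip+recip≤ 0<ε
... | t , 2/t≤ε = M ℕ.+ K₁ ℕ.* suc t , λ N N₀≤N → begin-strict
    ∣ x N ∣
  ≡⟨ cong ∣_∣ (x≡d N) ⟩
    ∣ d N ∣
  ≤⟨ ∣d∣≤ N ⟩
    nat C * errorBound N
  ≡⟨ cong (λ n → nat C * errorBound n) (ℕP.m+[n∸m]≡n (M≤N N₀≤N)) ⟨
    nat C * errorBound (M ℕ.+ (N ∸ M))
  ≤⟨ nat-*-errorBound≤ C M (N ∸ M) ⟩
    nat K₁ * recip (suc (M ℕ.+ (N ∸ M))) + nat K₂ * recip (suc M)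
  <⟨ ℚP.+-mono-< (nat-*-recip<recip K₁ (M ℕ.+ (N ∸ M)) t
                   (s≤s (ℕP.≤-trans (ℕP.m≤n+m (K₁ ℕ.* suc t) M)
                                    (ℕP.≤-trans N₀≤N (ℕP.≤-reflexive (sym (ℕP.m+[n∸m]≡n (M≤N N₀≤N))))))))
                 (nat-*-recip<recip K₂ M t ℕP.≤-refl) ⟩
    recip (suc t) + recip (suc t)
  ≤⟨ 2/t≤ε ⟩
    ε
  ∎
  where
  open ℚP.≤-Reasoning
  K₂ = C ℕ.* 2 ℕ.* 2
  M = K₂ ℕ.* suc t
  K₁ = K₂ ℕ.* M
  M≤N : ∀ {N} → M ℕ.+ K₁ ℕ.* suc t ≤ N → M ≤ N
  M≤N = ℕP.≤-trans (ℕP.m≤m+n M (K₁ ℕ.* suc t))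

cauchy≡zeta2+zeta2+zeta1-cauchyError : ∀ N s₁ a s₂ b → cauchy N (term s₁ a) (term s₂ b) ≡
  zeta2 N s₁ a s₂ b + zeta2 N s₂ b s₁ a + zeta1 N (s₁ xor s₂) (a ℕ.+ b) - cauchyError N s₁ a s₂ b
cauchy≡zeta2+zeta2+zeta1-cauchyError N s₁ a s₂ b = begin
    cauchy N (term s₁ a) (term s₂ b)
  ≡⟨ solve 2 (λ X T → T := X :- (X :- T)) refl (zeta1 N s₁ a * zeta1 N s₂ b) (cauchy N (term s₁ a) (term s₂ b)) ⟩
    zeta1 N s₁ a * zeta1 N s₂ b - cauchyError N s₁ a s₂ b
  ≡⟨ cong (_- cauchyError N s₁ a s₂ b) (zeta1-*-zeta1 N s₁ a s₂ b) ⟩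
    zeta2 N s₁ a s₂ b + zeta2 N s₂ b s₁ a + zeta1 N (s₁ xor s₂) (a ℕ.+ b) - cauchyError N s₁ a s₂ b
  ∎
  where open ≡-Reasoning

module _ (N n : ℕ) where

  zeta2Sum : Bool → Bool → ℚ
  zeta2Sum s₁ s₂ = sumTo n (λ a → zeta2 N s₁ a s₂ (suc n ∸ a))

  weightedZeta2Sum : Bool → Bool → ℚ
  weightedZeta2Sum s₁ s₂ = sumTo n (λ j → nat (2 ℕ.^ j) * zeta2 N s₁ j s₂ (suc n ∸ j))

  cauchySum : Bool → Bool → ℚ
  cauchySum s₁ s₂ = sumTo n (λ a → cauchy N (term s₁ a) (term s₂ (suc n ∸ a)))

  errorSum : Bool → Bool → ℚ
  errorSum s₁ s₂ = sumTo n (λ a → cauchyError N s₁ a s₂ (suc n ∸ a))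

  cauchySum≡ : ∀ s₁ s₂ → cauchySum s₁ s₂ ≡
    zeta2Sum s₁ s₂ + zeta2Sum s₂ s₁ + nat n * zeta1 N (s₁ xor s₂) (suc n) - errorSum s₁ s₂
  cauchySum≡ s₁ s₂ = begin
      cauchySum s₁ s₂
    ≡⟨ sumTo-cong n (λ i _ → cauchy≡zeta2+zeta2+zeta1-cauchyError N s₁ (suc i) s₂ (suc n ∸ suc i)) ⟩
      sumTo n (λ a → zeta2 N s₁ a s₂ (suc n ∸ a) + zeta2 N s₂ (suc n ∸ a) s₁ a + ζ (a ℕ.+ (suc n ∸ a))
                     - cauchyError N s₁ a s₂ (suc n ∸ a))
    ≡⟨ sumTo-- n _ _ ⟩
      sumTo n (λ a → zeta2 N s₁ a s₂ (suc n ∸ a) + zeta2 N s₂ (suc n ∸ a) s₁ a + ζ (a ℕ.+ (suc n ∸ a)))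
      - errorSum s₁ s₂
    ≡⟨ cong (_- errorSum s₁ s₂) (trans (sumTo-+ n _ _) (cong₂ _+_ (sumTo-+ n _ _)
         (trans (sumTo-cong n (λ i i<n → cong ζ (ℕP.m+[n∸m]≡n {suc i} {suc n} (ℕP.m≤n⇒m≤1+n i<n))))
                (sumTo-const n (ζ (suc n)))))) ⟩
      zeta2Sum s₁ s₂ + sumTo n (λ a → zeta2 N s₂ (suc n ∸ a) s₁ a) + nat n * ζ (suc n) - errorSum s₁ s₂
    ≡⟨ cong (λ t → zeta2Sum s₁ s₂ + t + nat n * ζ (suc n) - errorSum s₁ s₂)
         (trans (sumTo-reverse n (λ a → zeta2 N s₂ (suc n ∸ a) s₁ a))
                (sumTo-cong n (λ i i<n → cong (λ t → zeta2 N s₂ t s₁ (suc n ∸ suc i))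
                   (ℕP.m∸[m∸n]≡n {suc n} {suc i} (ℕP.m≤n⇒m≤1+n i<n))))) ⟩
      zeta2Sum s₁ s₂ + zeta2Sum s₂ s₁ + nat n * ζ (suc n) - errorSum s₁ s₂
    ∎
    where
    open ≡-Reasoning
    ζ = zeta1 N (s₁ xor s₂)

  weightedZeta2Sum-double : ∀ s₁ s₂ →
    sumTo n (λ j → nat (2 ℕ.^ j) * (zeta2 N s₁ j s₂ (suc n ∸ j) + zeta2 N s₁ j s₂ (suc n ∸ j)))
    ≡ nat 2 * weightedZeta2Sum s₁ s₂
  weightedZeta2Sum-double s₁ s₂ = trans
    (sumTo-cong n (λ i _ → solve 2 (λ c z → c :* (z :+ z) := con (nat 2) :* (c :* z)) refl
                             (nat (2 ℕ.^ suc i)) (zeta2 N s₁ (suc i) s₂ (suc n ∸ suc i))))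
    (sumTo-*ˡ n (nat 2) _)

  weightedZeta2Sum-+ : ∀ s₁ s₂ t₁ t₂ →
    sumTo n (λ j → nat (2 ℕ.^ j) * (zeta2 N s₁ j s₂ (suc n ∸ j) + zeta2 N t₁ j t₂ (suc n ∸ j)))
    ≡ weightedZeta2Sum s₁ s₂ + weightedZeta2Sum t₁ t₂
  weightedZeta2Sum-+ s₁ s₂ t₁ t₂ =
    trans (sumTo-cong n (λ i _ → ℚP.*-distribˡ-+ (nat (2 ℕ.^ suc i)) _ _)) (sumTo-+ n _ _)

sumJ-unfold : ∀ K f → sumJ (suc (suc K)) f ≡ sumTo (suc K) (λ j → nat (2 ℕ.^ j) * f j) - nat 2 * f 1
sumJ-unfold K f = begin
    sumJ (suc (suc K)) f
  ≡⟨ trans (sumTo-unfoldˡ K _) (cong (0ℚ +_) (sumTo-cong K (λ _ _ → refl))) ⟩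
    0ℚ + S
  ≡⟨ solve 2 (λ x s → con 0ℚ :+ s := x :+ s :- x) refl (nat 2 * f 1) S ⟩
    nat 2 * f 1 + S - nat 2 * f 1
  ≡⟨ cong (_- nat 2 * f 1) (sumTo-unfoldˡ K (λ j → nat (2 ℕ.^ j) * f j)) ⟨
    sumTo (suc K) (λ j → nat (2 ℕ.^ j) * f j) - nat 2 * f 1
  ∎
  where
  open ≡-Reasoning
  S = sumTo K (λ i → nat (2 ℕ.^ suc i) * f (suc i))

nat-2+ : ∀ n → nat (suc (suc n)) ≡ nat n + nat 2
nat-2+ n = trans (nat-suc (suc n)) (trans (cong (_+ 1ℚ) (nat-suc n)) (ℚP.+-assoc (nat n) 1ℚ 1ℚ))

nat-2*suc : ∀ n → nat (2 ℕ.* suc n) ≡ nat 2 + nat 2 * nat n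
nat-2*suc n = trans (nat-* 2 (suc n)) (trans (cong (nat 2 *_) (nat-suc n))
  (solve 2 (λ t n → t :* (n :+ con 1ℚ) := t :+ t :* n) refl (nat 2) (nat n)))

weightedZeta2Sum≡cauchySum : ∀ N n s → weightedZeta2Sum N n s (s xor s) ≡ cauchySum N n s s
weightedZeta2Sum≡cauchySum N n s = *-cancelˡ-≡ (nat 2) (λ ()) (begin
    nat 2 * weightedZeta2Sum N n s (s xor s)
  ≡⟨ weightedZeta2Sum-double N n s (s xor s) ⟨
    sumTo n (λ j → nat (2 ℕ.^ j) * (zeta2 N s j (s xor s) (suc n ∸ j) + zeta2 N s j (s xor s) (suc n ∸ j)))
  ≡⟨ sumTo-2^*zeta2≡2*sumTo-cauchy N s s (suc n) ⟩
    nat 2 * cauchySum N n s s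
  ∎)
  where open ≡-Reasoning

identity₁-defect : ∀ K N →
  sumJ (suc (suc K)) (λ j → zeta2 N false j false (suc (suc K) ∸ j))
    - nat (suc (suc (suc K))) * zeta1 N false (suc (suc K))
  ≡ - (nat 2 * cauchyError N false 1 false (suc K) + errorSum N (suc K) false false)
identity₁-defect K N = begin
    sumJ k (λ j → zeta2 N false j false (k ∸ j)) - nat (suc k) * ζ
  ≡⟨ cong₂ (λ a b → a - b * ζ) (sumJ-unfold K _) (nat-2+ n) ⟩
    weightedZeta2Sum N n false false - nat 2 * Z₁ - (nat n + nat 2) * ζ
  ≡⟨ cong (λ t → t - nat 2 * Z₁ - (nat n + nat 2) * ζ)
       (trans (weightedZeta2Sum≡cauchySum N n false) (cauchySum≡ N n false false)) ⟩
    Zs + Zs + nat n * ζ - Es - nat 2 * Z₁ - (nat n + nat 2) * ζ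
  ≡⟨ cong (λ t → t + t + nat n * ζ - Es - nat 2 * Z₁ - (nat n + nat 2) * ζ)
       (trans (sumTo-zeta2≡cauchy-∸-zeta2 N false false n)
              (cong (_- Zₙ) (cauchy≡zeta2+zeta2+zeta1-cauchyError N false 1 false n))) ⟩
    ((Z₁ + Zₙ + ζ - E) - Zₙ) + ((Z₁ + Zₙ + ζ - E) - Zₙ) + nat n * ζ - Es - nat 2 * Z₁ - (nat n + nat 2) * ζ
  ≡⟨ solve 6 (λ Z₁ Zₙ ζ E n Es →
         ((Z₁ :+ Zₙ :+ ζ :- E) :- Zₙ) :+ ((Z₁ :+ Zₙ :+ ζ :- E) :- Zₙ) :+ n :* ζ :- Es
           :- con (nat 2) :* Z₁ :- (n :+ con (nat 2)) :* ζ
         := :- (con (nat 2) :* E :+ Es)) refl Z₁ Zₙ ζ E (nat n) Es ⟩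
    - (nat 2 * E + Es)
  ∎
  where
  open ≡-Reasoning
  n = suc K
  k = suc n
  ζ = zeta1 N false k
  Z₁ = zeta2 N false 1 false n
  Zₙ = zeta2 N false n false 1
  Zs = zeta2Sum N n false false
  E = cauchyError N false 1 false n
  Es = errorSum N n false false

identity₂-defect : ∀ K N →
  (sumJ (suc (suc K)) (λ j → zeta2 N false j true (suc (suc K) ∸ j))
   + sumJ (suc (suc K)) (λ j → zeta2 N true j true (suc (suc K) ∸ j)))
    - (nat 2 * zeta1 N false (suc (suc K)) + nat (2 ℕ.* suc (suc K)) * zeta1 N true (suc (suc K)))
  ≡ - (nat 2 * cauchyError N true 1 true (suc K) + nat 2 * cauchyError N false 1 true (suc K)
       + nat 2 * errorSum N (suc K) true false)
identity₂-defect K N = begin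
    (sumJ k (λ j → zeta2 N false j true (k ∸ j)) + sumJ k (λ j → zeta2 N true j true (k ∸ j)))
      - (nat 2 * ζ + nat (2 ℕ.* k) * ζ̄)
  ≡⟨ cong₂ (λ a b → a - (nat 2 * ζ + b * ζ̄)) (cong₂ _+_ (sumJ-unfold K _) (sumJ-unfold K _)) (nat-2*suc n) ⟩
    (W₀ - nat 2 * a) + (W₁ - nat 2 * b) - rhs
  ≡⟨ solve 5 (λ W₀ W₁ a b r → (W₀ :- con (nat 2) :* a) :+ (W₁ :- con (nat 2) :* b) :- r
                              := (W₁ :+ W₀) :- con (nat 2) :* a :- con (nat 2) :* b :- r)
       refl W₀ W₁ a b rhs ⟩
    (W₁ + W₀) - nat 2 * a - nat 2 * b - rhs
  ≡⟨ cong (λ t → t - nat 2 * a - nat 2 * b - rhs)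
       (trans (sym (weightedZeta2Sum-+ N n true true false true))
       (trans (sumTo-2^*zeta2≡2*sumTo-cauchy N true false k)
              (cong (nat 2 *_) (cauchySum≡ N n true false)))) ⟩
    nat 2 * (Zs₁ + Zs₂ + nat n * ζ̄ - Es) - nat 2 * a - nat 2 * b - rhs
  ≡⟨ cong₂ (λ x y → nat 2 * (x + y + nat n * ζ̄ - Es) - nat 2 * a - nat 2 * b - rhs)
       (trans (sumTo-zeta2≡cauchy-∸-zeta2 N true true n)
              (cong (_- X₁) (cauchy≡zeta2+zeta2+zeta1-cauchyError N true 1 true n)))
       (trans (sumTo-zeta2≡cauchy-∸-zeta2 N false true n)
              (cong (_- X₂) (cauchy≡zeta2+zeta2+zeta1-cauchyError N false 1 true n))) ⟩
    nat 2 * (((b + X₂ + ζ - E₁) - X₁) + ((a + X₁ + ζ̄ - E₂) - X₂) + nat n * ζ̄ - Es)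
      - nat 2 * a - nat 2 * b - rhs
  ≡⟨ solve 10 (λ a b X₁ X₂ ζ ζ̄ E₁ E₂ n Es →
         con (nat 2) :* (((b :+ X₂ :+ ζ :- E₁) :- X₁) :+ ((a :+ X₁ :+ ζ̄ :- E₂) :- X₂) :+ n :* ζ̄ :- Es)
           :- con (nat 2) :* a :- con (nat 2) :* b
           :- (con (nat 2) :* ζ :+ (con (nat 2) :+ con (nat 2) :* n) :* ζ̄)
         := :- (con (nat 2) :* E₁ :+ con (nat 2) :* E₂ :+ con (nat 2) :* Es))
       refl a b X₁ X₂ ζ ζ̄ E₁ E₂ (nat n) Es ⟩
    - (nat 2 * E₁ + nat 2 * E₂ + nat 2 * Es)
  ∎
  where
  open ≡-Reasoning
  n = suc K
  k = suc n
  ζ = zeta1 N false k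
  ζ̄ = zeta1 N true k
  rhs = nat 2 * ζ + (nat 2 + nat 2 * nat n) * ζ̄
  a = zeta2 N false 1 true n
  b = zeta2 N true 1 true n
  X₁ = zeta2 N true n false 1
  X₂ = zeta2 N true n true 1
  W₀ = weightedZeta2Sum N n false true
  W₁ = weightedZeta2Sum N n true true
  Zs₁ = zeta2Sum N n true false
  Zs₂ = zeta2Sum N n false true
  E₁ = cauchyError N true 1 true n
  E₂ = cauchyError N false 1 true n
  Es = errorSum N n true false

identity₃-defect : ∀ K N →
  sumJ (suc (suc K)) (λ j → zeta2 N true j false (suc (suc K) ∸ j))
    - (nat (suc (suc K) ∸ 1) * zeta1 N false (suc (suc K)) + nat 2 * zeta1 N true (suc (suc K)))
  ≡ - (nat 2 * cauchyError N true 1 false (suc K) + errorSum N (suc K) true true)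
identity₃-defect K N = begin
    sumJ k (λ j → zeta2 N true j false (k ∸ j)) - rhs
  ≡⟨ cong (_- rhs) (sumJ-unfold K _) ⟩
    weightedZeta2Sum N n true false - nat 2 * Z₁ - rhs
  ≡⟨ cong (λ t → t - nat 2 * Z₁ - rhs)
       (trans (weightedZeta2Sum≡cauchySum N n true) (cauchySum≡ N n true true)) ⟩
    Zs + Zs + nat n * ζ - Es - nat 2 * Z₁ - rhs
  ≡⟨ cong (λ t → t + t + nat n * ζ - Es - nat 2 * Z₁ - rhs)
       (trans (sumTo-zeta2≡cauchy-∸-zeta2 N true false n)
              (cong (_- Zₙ) (cauchy≡zeta2+zeta2+zeta1-cauchyError N true 1 false n))) ⟩
    ((Z₁ + Zₙ + ζ̄ - E) - Zₙ) + ((Z₁ + Zₙ + ζ̄ - E) - Zₙ) + nat n * ζ - Es - nat 2 * Z₁ - rhs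
  ≡⟨ solve 7 (λ Z₁ Zₙ ζ ζ̄ E n Es →
         ((Z₁ :+ Zₙ :+ ζ̄ :- E) :- Zₙ) :+ ((Z₁ :+ Zₙ :+ ζ̄ :- E) :- Zₙ) :+ n :* ζ :- Es
           :- con (nat 2) :* Z₁ :- (n :* ζ :+ con (nat 2) :* ζ̄)
         := :- (con (nat 2) :* E :+ Es)) refl Z₁ Zₙ ζ ζ̄ E (nat n) Es ⟩
    - (nat 2 * E + Es)
  ∎
  where
  open ≡-Reasoning
  n = suc K
  k = suc n
  ζ = zeta1 N false k
  ζ̄ = zeta1 N true k
  rhs = nat n * ζ + nat 2 * ζ̄
  Z₁ = zeta2 N true 1 false n
  Zₙ = zeta2 N false n true 1
  Zs = zeta2Sum N n true true
  E = cauchyError N true 1 false n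
  Es = errorSum N n true true

∣errorSum∣≤ : ∀ N K s₁ s₂ → ∣ errorSum N (suc (suc K)) s₁ s₂ ∣ ℚ.≤ nat (suc (suc K)) * errorBound N
∣errorSum∣≤ N K s₁ s₂ = begin
    ∣ errorSum N n s₁ s₂ ∣
  ≤⟨ ∣sumTo∣≤sumTo∣∣ n _ ⟩
    sumTo n (λ a → ∣ cauchyError N s₁ a s₂ (suc n ∸ a) ∣)
  ≤⟨ sumTo-mono-≤ n (λ i i<n → ∣cauchyError∣≤errorBound N s₁ (suc i) s₂ (suc n ∸ suc i)
       (s≤s z≤n) (ℕP.m<n⇒0<n∸m (s≤s i<n))
       (ℕP.≤-trans (s≤s (s≤s (s≤s z≤n)))
                   (ℕP.≤-reflexive (sym (ℕP.m+[n∸m]≡n {suc i} {suc n} (ℕP.m≤n⇒m≤1+n i<n)))))) ⟩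
    sumTo n (λ _ → errorBound N)
  ≡⟨ sumTo-const n (errorBound N) ⟩
    nat n * errorBound N
  ∎
  where
  open ℚP.≤-Reasoning
  n = suc (suc K)

∣cauchyError-1∣≤ : ∀ N K s₁ s₂ → ∣ cauchyError N s₁ 1 s₂ (suc (suc K)) ∣ ℚ.≤ errorBound N
∣cauchyError-1∣≤ N K s₁ s₂ =
  ∣cauchyError∣≤errorBound N s₁ 1 s₂ (suc (suc K)) (s≤s z≤n) (s≤s z≤n) (s≤s (s≤s (s≤s z≤n)))

∣2*∣≤ : ∀ {x y} → ∣ x ∣ ℚ.≤ y → ∣ nat 2 * x ∣ ℚ.≤ nat 2 * y
∣2*∣≤ {x} ∣x∣≤y = ℚP.≤-trans (ℚP.≤-reflexive (ℚP.∣p*q∣≡∣p∣*∣q∣ (nat 2) x))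
                             (ℚP.*-monoˡ-≤-nonNeg (nat 2) ∣x∣≤y)

∣-[2*e+s]∣≤ : ∀ {e s B} n → ∣ e ∣ ℚ.≤ B → ∣ s ∣ ℚ.≤ nat n * B → ∣ - (nat 2 * e + s) ∣ ℚ.≤ nat (suc (suc n)) * B
∣-[2*e+s]∣≤ {e} {s} {B} n ∣e∣≤B ∣s∣≤nB = begin
    ∣ - (nat 2 * e + s) ∣
  ≡⟨ ℚP.∣-p∣≡∣p∣ _ ⟩
    ∣ nat 2 * e + s ∣
  ≤⟨ ℚP.∣p+q∣≤∣p∣+∣q∣ (nat 2 * e) s ⟩
    ∣ nat 2 * e ∣ + ∣ s ∣
  ≤⟨ ℚP.+-mono-≤ (∣2*∣≤ ∣e∣≤B) ∣s∣≤nB ⟩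
    nat 2 * B + nat n * B
  ≡⟨ ℚP.*-distribʳ-+ B (nat 2) (nat n) ⟨
    (nat 2 + nat n) * B
  ≡⟨ cong (_* B) (trans (ℚP.+-comm (nat 2) (nat n)) (sym (nat-2+ n))) ⟩
    nat (suc (suc n)) * B
  ∎
  where open ℚP.≤-Reasoning

∣-[2*e+2*e′+2*s]∣≤ : ∀ {e e′ s B} n → ∣ e ∣ ℚ.≤ B → ∣ e′ ∣ ℚ.≤ B → ∣ s ∣ ℚ.≤ nat n * B →
                     ∣ - (nat 2 * e + nat 2 * e′ + nat 2 * s) ∣ ℚ.≤ nat (2 ℕ.* suc (suc n)) * B
∣-[2*e+2*e′+2*s]∣≤ {e} {e′} {s} {B} n ∣e∣≤B ∣e′∣≤B ∣s∣≤nB = begin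
    ∣ - (nat 2 * e + nat 2 * e′ + nat 2 * s) ∣
  ≡⟨ ℚP.∣-p∣≡∣p∣ _ ⟩
    ∣ nat 2 * e + nat 2 * e′ + nat 2 * s ∣
  ≤⟨ ℚP.≤-trans (ℚP.∣p+q∣≤∣p∣+∣q∣ (nat 2 * e + nat 2 * e′) (nat 2 * s))
                (ℚP.+-monoˡ-≤ ∣ nat 2 * s ∣ (ℚP.∣p+q∣≤∣p∣+∣q∣ (nat 2 * e) (nat 2 * e′))) ⟩
    ∣ nat 2 * e ∣ + ∣ nat 2 * e′ ∣ + ∣ nat 2 * s ∣
  ≤⟨ ℚP.+-mono-≤ (ℚP.+-mono-≤ (∣2*∣≤ ∣e∣≤B) (∣2*∣≤ ∣e′∣≤B)) (∣2*∣≤ ∣s∣≤nB) ⟩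
    nat 2 * B + nat 2 * B + nat 2 * (nat n * B)
  ≡⟨ solve 3 (λ t B n → t :* B :+ t :* B :+ t :* (n :* B) := t :* (n :+ con (nat 2)) :* B) refl (nat 2) B (nat n) ⟩
    nat 2 * (nat n + nat 2) * B
  ≡⟨ cong (_* B) (trans (cong (nat 2 *_) (sym (nat-2+ n))) (sym (nat-* 2 (suc (suc n))))) ⟩
    nat (2 ℕ.* suc (suc n)) * B
  ∎
  where open ℚP.≤-Reasoning

corollary4p8 : ∀ (k : ℕ) → 3 ≤ k →
    TendsToZero (λ N → sumJ k (λ j → zeta2 N false j false (k Data.Nat.∸ j))
                       - nat (Data.Nat.suc k) * zeta1 N false k)
    × TendsToZero (λ N → (sumJ k (λ j → zeta2 N false j true (k Data.Nat.∸ j))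
                          + sumJ k (λ j → zeta2 N true j true (k Data.Nat.∸ j)))
                       - (nat 2 * zeta1 N false k + nat (2 Data.Nat.* k) * zeta1 N true k))
    × TendsToZero (λ N → sumJ k (λ j → zeta2 N true j false (k Data.Nat.∸ j))
                       - (nat (k Data.Nat.∸ 1) * zeta1 N false k + nat 2 * zeta1 N true k))
corollary4p8 (suc (suc (suc K))) _ =
    tendsToZero-≤-errorBound (suc (suc n)) (identity₁-defect (suc K))
      (λ N → ∣-[2*e+s]∣≤ n (∣cauchyError-1∣≤ N K false false) (∣errorSum∣≤ N K false false))
  , tendsToZero-≤-errorBound (2 ℕ.* suc (suc n)) (identity₂-defect (suc K))
      (λ N → ∣-[2*e+2*e′+2*s]∣≤ n (∣cauchyError-1∣≤ N K true true) (∣cauchyError-1∣≤ N K false true)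
                                  (∣errorSum∣≤ N K true false))
  , tendsToZero-≤-errorBound (suc (suc n)) (identity₃-defect (suc K))
      (λ N → ∣-[2*e+s]∣≤ n (∣cauchyError-1∣≤ N K true false) (∣errorSum∣≤ N K true true))
  where n = suc (suc K)
corollary4p8 (suc zero)       (s≤s ())
corollary4p8 (suc (suc zero)) (s≤s (s≤s ()))
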